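{- Let $n$ and $m$ be integers with $5\le m\le n-1$. Let $d=n-\lfloor\frac{m+1}{2}\rfloor$ and $a=n-m$. Then ${}^rD'(U_{n,m,d}(a,0))<{}^rD'(U_{n,m-2,d+1}(a+2,0))$.
   Context: All graphs are finite, simple and connected. For a graph $G$, $d_G(x,y)$ is the distance, $D_G(x)=\sum_{y}d_G(x,y)$, $d_G(x)$ the degree, and $D'(G)=\sum_{x}d_G(x)D_G(x)$ the degree distance. The reverse degree distance of a graph $G$ with $n$ vertices, $e$ edges and diameter $d$ is ${}^rD'(G)=2(n-1)ed-D'(G)$. Attaching a path $P_s$ ($s\ge1$) to $w$ means adding new vertices $w_1,\dots,w_s$ with edges $ww_1,w_1w_2,\dots,w_{s-1}w_s$ (nothing for $s=0$); attaching $h$ pendant vertices to $w$ means adding $h$ new vertices each joined only to $w$. For integers $n,m,d$ and integers $a\ge b\ge0$ with $a\ge1$ and $a+b=d-\lfloor\frac m2\rfloor$, $U_{n,m,d}(a,b)$ is the unicyclic graph obtained from the cycle $C_m=v_0v_1\cdots v_{m-1}v_0$ by attaching a path $P_a$ to $v_0$, a path $P_b$ to $v_{\lfloor m/2\rfloor}$, and $n-d-\lfloor\frac{m+1}{2}\rfloor$ pendant vertices to $v_0$. -}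

module Defs where

open import Data.Nat using (ℕ; zero; suc; _+_; _*_; _∸_; _≡ᵇ_; _⊔_; _/_)
open import Data.Bool using (Bool; true; false; _∨_; _∧_; if_then_else_)
open import Data.List using (List; []; _∷_; map; upTo; filter; length; foldr; _++_)
open import Data.Nat.ListAction using (sum)
open import Data.Bool.ListAction using (any)
open import Data.Product using (_×_; _,_)
open import Data.Integer using (ℤ; +_; _-_)
open import Relation.Nullary.Decidable using (T?)

-- A finite graph on the vertex set {0,…,N-1}, given by a Boolean
-- adjacency function (symmetric, irreflexive for the graphs below).
record Graph : Set where
  field
    N   : ℕ
    adj : ℕ → ℕ → Bool
open Graph public

vertices : Graph → List ℕ
vertices G = upTo (N G)

reach : Graph → ℕ → ℕ → ℕ → Bool
reach G zero    x y = x ≡ᵇ y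
reach G (suc k) x y =
  reach G k x y ∨ any (λ z → reach G k x z ∧ adj G z y) (vertices G)

-- least k in the list with reach G k x y (default: fuel value)
firstReach : Graph → ℕ → ℕ → List ℕ → ℕ
firstReach G x y []       = N G
firstReach G x y (k ∷ ks) = if reach G k x y then k else firstReach G x y ks

-- distance d_G(x,y): length of a shortest walk (for connected G, < N)
dist : Graph → ℕ → ℕ → ℕ
dist G x y = firstReach G x y (upTo (N G))

deg : Graph → ℕ → ℕ
deg G x = length (filter (λ y → T? (adj G x y)) (vertices G))

-- number of edges e(G) (handshake)
edges : Graph → ℕ
edges G = sum (map (deg G) (vertices G)) / 2

trans : Graph → ℕ → ℕ
trans G x = sum (map (dist G x) (vertices G))

diam : Graph → ℕ
diam G = foldr _⊔_ 0 (map (λ x → foldr _⊔_ 0 (map (dist G x) (vertices G))) (vertices G))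

degDist : Graph → ℕ
degDist G = sum (map (λ x → deg G x * trans G x) (vertices G))

revDegDist : Graph → ℤ
revDegDist G = + (2 * (N G ∸ 1) * edges G * diam G) - + degDist G

pathEdges : ℕ → ℕ → ℕ → List (ℕ × ℕ)
pathEdges w start zero    = []
pathEdges w start (suc k) =
  (w , start) ∷ map (λ i → (start + i , start + suc i)) (upTo k)

cycleEdges : ℕ → List (ℕ × ℕ)
cycleEdges m = (m ∸ 1 , 0) ∷ map (λ i → (i , suc i)) (upTo (m ∸ 1))

adjOf : List (ℕ × ℕ) → ℕ → ℕ → Bool
adjOf es x y = any (λ { (p , q) → ((p ≡ᵇ x) ∧ (q ≡ᵇ y)) ∨ ((p ≡ᵇ y) ∧ (q ≡ᵇ x)) }) es

-- Vertices: cycle v_i = i (i < m); P_a on m,…,m+a-1 attached to v_0;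
-- P_b on m+a,…,m+a+b-1 attached to v_{⌊m/2⌋};
-- h = n - d - ⌊(m+1)/2⌋ pendant vertices m+a+b,…, attached to v_0.
U : ℕ → ℕ → ℕ → ℕ → ℕ → Graph
U n m d a b = record
  { N   = m + a + b + h
  ; adj = adjOf (cycleEdges m
                 ++ pathEdges 0 m a
                 ++ pathEdges (m / 2) (m + a) b
                 ++ map (λ i → (0 , m + a + b + i)) (upTo h))
  }
  where h = n ∸ d ∸ ((m + 1) / 2)

-- For d = n - ⌊(m+1)/2⌋ neither graph has pendant vertices: both are tadpoles T(m, a), a cycle C_m
-- with a path of a vertices hanging from one of its vertices, on n = m + a vertices and n edges.
-- Writing down all distances (any function satisfying the breadth-first-search recurrences is the
-- graph distance) gives diam T(m, a) = ⌊m/2⌋ + a and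
--   3 D'(T(m, a)) = 6mS + 12aS + 6ma² + 3ma + 2a³ + a,  where S(m) = Σ_j d_{C_m}(v₀, v_j).
-- Passing from T(m, a) to T(m-2, a+2) raises the diameter by one, so ^rD' grows by
-- 2(n-1)n - (D'(T(m-2, a+2)) - D'(T(m, a))); the formula with S(m) = S(m-2) + m - 1 and
-- S(m-2) ≤ (m-2)² shows that the difference of degree distances is smaller than 2(n-1)n.

module Submission where

open import Defs
open import Data.Nat
open import Data.Integer using () renaming (_<_ to _<ℤ_)
open import Data.Nat.Properties
open import Data.Bool using (Bool; true; false; _∨_; _∧_; T)
open import Data.Bool.Properties using (T-∨; T-∧)
open import Data.List using (List; []; _∷_; map; upTo; applyUpTo; filter; length; foldr; _++_)
open import Data.List.Properties using (++-identityʳ)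
open import Data.List.Membership.Propositional using (_∈_; _∉_)
open import Data.List.Relation.Unary.All using (All; []; _∷_; lookup)
import Data.List.Relation.Unary.All as All
open import Data.List.Relation.Unary.Any using (Any; here; there)
import Data.List.Relation.Unary.Any as Any
open import Data.List.Relation.Unary.Any.Properties using (any⁺; any⁻; applyUpTo⁺; applyUpTo⁻; ++⁺ˡ; ++⁺ʳ; ++⁻; map⁺; map⁻)
open import Data.Bool.ListAction using (any)
open import Data.List.Relation.Unary.AllPairs using ([]; _∷_)
open import Data.List.Relation.Unary.Unique.Propositional using (Unique)
open import Data.Nat.ListAction using (sum)
open import Data.Nat.DivMod using (m*n/n≡m; m≡m%n+[m/n]*n; m%n<n; m/n*n≤m; m/n<m; m/n≡1+[m∸n]/n)
open import Data.Product using (∃-syntax; _×_; _,_; proj₁; proj₂)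
open import Data.Sum using (_⊎_; inj₁; inj₂)
import Data.Sum
open import Data.Empty using (⊥-elim)
open import Data.Unit using (tt)
open import Function using (_∘_; id; Equivalence)
open import Relation.Nullary using (Dec; yes; no)
open import Relation.Binary.Definitions using (tri<; tri≈; tri>)
open import Relation.Nullary.Decidable using (T?)
open import Relation.Binary.PropositionalEquality
  using (_≡_; _≢_; refl; sym; cong; cong₂; subst; subst₂; module ≡-Reasoning)
import Relation.Binary.PropositionalEquality as ≡
open import Data.Nat.Tactic.RingSolver using (solve-∀)
import Data.Integer as ℤ
import Data.Integer.Properties as ℤ

∑ : ℕ → (ℕ → ℕ) → ℕ
∑ zero    f = 0
∑ (suc n) f = f 0 + ∑ n (f ∘ suc)

syntax ∑ n (λ i → e) = ∑[ i < n ] e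

∑-cong : ∀ n {f g : ℕ → ℕ} → (∀ i → i < n → f i ≡ g i) → ∑ n f ≡ ∑ n g
∑-cong zero    f≗g = refl
∑-cong (suc n) f≗g = cong₂ _+_ (f≗g 0 z<s) (∑-cong n (λ i i<n → f≗g (suc i) (s<s i<n)))

∑-mono-≤ : ∀ n {f g : ℕ → ℕ} → (∀ i → i < n → f i ≤ g i) → ∑ n f ≤ ∑ n g
∑-mono-≤ zero    f≤g = z≤n
∑-mono-≤ (suc n) f≤g = +-mono-≤ (f≤g 0 z<s) (∑-mono-≤ n (λ i i<n → f≤g (suc i) (s<s i<n)))

∑-suc : ∀ n (f : ℕ → ℕ) → ∑ (suc n) f ≡ ∑ n f + f n
∑-suc zero    f = +-comm (f 0) 0
∑-suc (suc n) f = ≡.trans (cong (f 0 +_) (∑-suc n (f ∘ suc))) (sym (+-assoc (f 0) _ _))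

∑-+ : ∀ m n (f : ℕ → ℕ) → ∑ (m + n) f ≡ ∑ m f + ∑[ i < n ] f (m + i)
∑-+ zero    n f = refl
∑-+ (suc m) n f = ≡.trans (cong (f 0 +_) (∑-+ m n (f ∘ suc))) (sym (+-assoc (f 0) _ _))

∑-distrib-+ : ∀ n (f g : ℕ → ℕ) → ∑[ i < n ] (f i + g i) ≡ ∑ n f + ∑ n g
∑-distrib-+ zero    f g = refl
∑-distrib-+ (suc n) f g = begin
  f 0 + g 0 + ∑[ i < n ] (f (suc i) + g (suc i))  ≡⟨ cong (f 0 + g 0 +_) (∑-distrib-+ n (f ∘ suc) (g ∘ suc)) ⟩
  f 0 + g 0 + (∑ n (f ∘ suc) + ∑ n (g ∘ suc))     ≡⟨ +-comm-middle (f 0) (g 0) _ _ ⟩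
  f 0 + ∑ n (f ∘ suc) + (g 0 + ∑ n (g ∘ suc))     ∎
  where
  open ≡-Reasoning
  +-comm-middle : ∀ a b c d → a + b + (c + d) ≡ a + c + (b + d)
  +-comm-middle = solve-∀

∑-*ˡ : ∀ n c (f : ℕ → ℕ) → ∑[ i < n ] (c * f i) ≡ c * ∑ n f
∑-*ˡ zero    c f = sym (*-zeroʳ c)
∑-*ˡ (suc n) c f = ≡.trans (cong (c * f 0 +_) (∑-*ˡ n c (f ∘ suc))) (sym (*-distribˡ-+ c (f 0) _))

∑-const : ∀ n c → ∑[ _ < n ] c ≡ n * c
∑-const zero    c = refl
∑-const (suc n) c = cong (c +_) (∑-const n c)

sum-map-applyUpTo : ∀ n (g f : ℕ → ℕ) → sum (map g (applyUpTo f n)) ≡ ∑ n (g ∘ f)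
sum-map-applyUpTo zero    g f = refl
sum-map-applyUpTo (suc n) g f = cong (g (f 0) +_) (sum-map-applyUpTo n g (f ∘ suc))

max-map-applyUpTo-≤ : ∀ n (g f : ℕ → ℕ) {B} → (∀ i → i < n → g (f i) ≤ B) →
                      foldr _⊔_ 0 (map g (applyUpTo f n)) ≤ B
max-map-applyUpTo-≤ zero    g f gf≤B = z≤n
max-map-applyUpTo-≤ (suc n) g f gf≤B =
  ⊔-lub (gf≤B 0 z<s) (max-map-applyUpTo-≤ n g (f ∘ suc) (λ i i<n → gf≤B (suc i) (s<s i<n)))

≤-max-map-applyUpTo : ∀ n (g f : ℕ → ℕ) {i} → i < n → g (f i) ≤ foldr _⊔_ 0 (map g (applyUpTo f n))
≤-max-map-applyUpTo (suc n) g f {zero}  i<n       = m≤m⊔n _ _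
≤-max-map-applyUpTo (suc n) g f {suc i} (s<s i<n) =
  ≤-trans (≤-max-map-applyUpTo n g (f ∘ suc) i<n) (m≤n⊔m _ _)

𝟙 : Bool → ℕ
𝟙 true  = 1
𝟙 false = 0

length-filter-applyUpTo : ∀ n (p : ℕ → Bool) (f : ℕ → ℕ) →
                          length (filter (T? ∘ p) (applyUpTo f n)) ≡ ∑ n (𝟙 ∘ p ∘ f)
length-filter-applyUpTo zero    p f = refl
length-filter-applyUpTo (suc n) p f with p (f 0)
... | true  = cong suc (length-filter-applyUpTo n p (f ∘ suc))
... | false = length-filter-applyUpTo n p (f ∘ suc)

𝟙-≡ᵇ-refl : ∀ p → 𝟙 (p ≡ᵇ p) ≡ 1
𝟙-≡ᵇ-refl p with p ≡ᵇ p in eq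
... | true  = refl
... | false = ⊥-elim (subst T eq (≡⇒≡ᵇ p p refl))

𝟙-≡ᵇ-≢ : ∀ {y p} → y ≢ p → 𝟙 (y ≡ᵇ p) ≡ 0
𝟙-≡ᵇ-≢ {y} {p} y≢p with y ≡ᵇ p in eq
... | true  = ⊥-elim (y≢p (≡ᵇ⇒≡ y p (subst T (sym eq) tt)))
... | false = refl

∑-𝟙-≡ᵇ : ∀ n {p} → p < n → ∑[ y < n ] 𝟙 (y ≡ᵇ p) ≡ 1
∑-𝟙-≡ᵇ (suc n) {p} p<1+n with p ≟ n
... | yes refl = begin
  ∑ (suc p) (λ y → 𝟙 (y ≡ᵇ p))            ≡⟨ ∑-suc p _ ⟩
  ∑ p (λ y → 𝟙 (y ≡ᵇ p)) + 𝟙 (p ≡ᵇ p)     ≡⟨ cong₂ _+_ (∑-cong p (λ y y<p → 𝟙-≡ᵇ-≢ (<⇒≢ y<p))) (𝟙-≡ᵇ-refl p) ⟩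
  ∑[ _ < p ] 0 + 1                         ≡⟨ cong (_+ 1) (≡.trans (∑-const p 0) (*-zeroʳ p)) ⟩
  1                                        ∎
  where open ≡-Reasoning
... | no p≢n = begin
  ∑ (suc n) (λ y → 𝟙 (y ≡ᵇ p))            ≡⟨ ∑-suc n _ ⟩
  ∑ n (λ y → 𝟙 (y ≡ᵇ p)) + 𝟙 (n ≡ᵇ p)     ≡⟨ cong₂ _+_ (∑-𝟙-≡ᵇ n (≤∧≢⇒< (≤-pred p<1+n) p≢n)) (𝟙-≡ᵇ-≢ (p≢n ∘ sym)) ⟩
  1                                        ∎
  where open ≡-Reasoning

multiplicity : ℕ → List ℕ → ℕ
multiplicity y ps = sum (map (λ p → 𝟙 (y ≡ᵇ p)) ps)

multiplicity-∉ : ∀ {y} ps → y ∉ ps → multiplicity y ps ≡ 0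
multiplicity-∉ []       y∉ps = refl
multiplicity-∉ (p ∷ ps) y∉ps =
  cong₂ _+_ (𝟙-≡ᵇ-≢ (y∉ps ∘ here)) (multiplicity-∉ ps (y∉ps ∘ there))

multiplicity-unique : ∀ {y ps} → Unique ps → y ∈ ps → multiplicity y ps ≡ 1
multiplicity-unique {ps = p ∷ ps} (p≢ps ∷ _) (here refl) =
  cong₂ _+_ (𝟙-≡ᵇ-refl p) (multiplicity-∉ ps (λ p∈ps → lookup p≢ps p∈ps refl))
multiplicity-unique {y} {p ∷ ps} (p≢ps ∷ ps!) (there y∈ps) =
  cong₂ _+_ (𝟙-≡ᵇ-≢ {y} {p} (λ { refl → lookup p≢ps y∈ps refl })) (multiplicity-unique ps! y∈ps)

∑-multiplicity : ∀ n ps → All (_< n) ps → ∑[ y < n ] multiplicity y ps ≡ length ps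
∑-multiplicity n []       []            = ≡.trans (∑-const n 0) (*-zeroʳ n)
∑-multiplicity n (p ∷ ps) (p<n ∷ ps<n) =
  ≡.trans (∑-distrib-+ n _ _) (cong₂ _+_ (∑-𝟙-≡ᵇ n p<n) (∑-multiplicity n ps ps<n))

∑-𝟙-exactly : ∀ n (A : ℕ → Bool) ps → Unique ps → All (_< n) ps → All (T ∘ A) ps →
              (∀ y → T (A y) → y ∈ ps) → ∑[ y < n ] 𝟙 (A y) ≡ length ps
∑-𝟙-exactly n A ps ps! ps<n Aps A⊆ps =
  ≡.trans (∑-cong n (λ y _ → 𝟙≡multiplicity y)) (∑-multiplicity n ps ps<n)
  where
  𝟙≡multiplicity : ∀ y → 𝟙 (A y) ≡ multiplicity y ps
  𝟙≡multiplicity y with A y in eq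
  ... | true  = sym (multiplicity-unique ps! (A⊆ps y (subst T (sym eq) tt)))
  ... | false = sym (multiplicity-∉ ps (λ y∈ps → subst T eq (lookup Aps y∈ps)))

-- Graph distances

record IsGraphDistance (G : Graph) (δ : ℕ → ℕ → ℕ) : Set where
  field
    δ≡0⇒≡         : ∀ {x y} → x < N G → y < N G → δ x y ≡ 0 → x ≡ y
    δ-refl         : ∀ x → δ x x ≡ 0
    δ-adj-≤        : ∀ {x y z} → x < N G → T (adj G z y) → δ x y ≤ suc (δ x z)
    δ-predecessor  : ∀ {x y} → x < N G → y < N G → 0 < δ x y →
                     ∃[ z ] z < N G × T (adj G z y) × suc (δ x z) ≡ δ x y
    δ<N            : ∀ {x y} → x < N G → y < N G → δ x y < N G

module GraphDistance {G : Graph} {δ : ℕ → ℕ → ℕ} (isDist : IsGraphDistance G δ) where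

  open IsGraphDistance isDist

  private
    any-applyUpTo⁻ : ∀ (p : ℕ → Bool) n → T (any p (upTo n)) → ∃[ i ] i < n × T (p i)
    any-applyUpTo⁻ p n h = applyUpTo⁻ id (any⁻ p (upTo n) h)

  reach⇒δ≤ : ∀ k {x y} → x < N G → y < N G → T (reach G k x y) → δ x y ≤ k
  reach⇒δ≤ zero    {x} {y} x<N y<N h rewrite ≡ᵇ⇒≡ x y h = ≤-reflexive (δ-refl y)
  reach⇒δ≤ (suc k) {x} {y} x<N y<N h with Equivalence.to T-∨ h
  ... | inj₁ h′ = m≤n⇒m≤1+n (reach⇒δ≤ k x<N y<N h′)
  ... | inj₂ h′ with any-applyUpTo⁻ (λ z → reach G k x z ∧ adj G z y) (N G) h′
  ... | z , z<N , rz with Equivalence.to T-∧ rz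
  ... | reach-xz , adj-zy = ≤-trans (δ-adj-≤ x<N adj-zy) (s≤s (reach⇒δ≤ k x<N z<N reach-xz))

  δ≤⇒reach : ∀ k {x y} → x < N G → y < N G → δ x y ≤ k → T (reach G k x y)
  δ≤⇒reach zero    {x} {y} x<N y<N δ≤0 = ≡⇒≡ᵇ x y (δ≡0⇒≡ x<N y<N (n≤0⇒n≡0 δ≤0))
  δ≤⇒reach (suc k) {x} {y} x<N y<N δ≤k+1 with δ x y ≤? k
  ... | yes δ≤k = Equivalence.from T-∨ (inj₁ (δ≤⇒reach k x<N y<N δ≤k))
  ... | no  δ≰k with δ-predecessor x<N y<N (≤-trans (s≤s z≤n) (≰⇒> δ≰k))
  ... | z , z<N , adj-zy , δz+1≡δ =
    Equivalence.from T-∨ (inj₂ (any⁺ _ (applyUpTo⁺ id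
      (Equivalence.from T-∧ (δ≤⇒reach k x<N z<N δz≤k , adj-zy)) z<N)))
    where
    δz≤k : δ x z ≤ k
    δz≤k = ≤-reflexive (suc-injective (≡.trans δz+1≡δ (≤-antisym δ≤k+1 (≰⇒> δ≰k))))

  firstReach≡δ : ∀ r j (f : ℕ → ℕ) {x y} → (∀ i → f i ≡ j + i) → x < N G → y < N G →
                 j ≤ δ x y → δ x y < j + r → firstReach G x y (applyUpTo f r) ≡ δ x y
  firstReach≡δ zero    j f f≗j+ x<N y<N j≤δ δ<j+r =
    ⊥-elim (<-irrefl refl (≤-trans δ<j+r (≤-trans (≤-reflexive (+-identityʳ j)) j≤δ)))
  firstReach≡δ (suc r) j f {x} {y} f≗j+ x<N y<N j≤δ δ<j+r with reach G (f 0) x y in eq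
  ... | true  = ≤-antisym (subst (_≤ δ x y) (sym (≡.trans (f≗j+ 0) (+-identityʳ j))) j≤δ)
                          (reach⇒δ≤ (f 0) x<N y<N (subst T (sym eq) tt))
  ... | false with j ≟ δ x y
  ... | yes refl = ⊥-elim (subst T eq (δ≤⇒reach (f 0) x<N y<N (≤-reflexive (sym (≡.trans (f≗j+ 0) (+-identityʳ j))))))
  ... | no  j≢δ  = firstReach≡δ r (suc j) (f ∘ suc) (λ i → ≡.trans (f≗j+ (suc i)) (+-suc j i)) x<N y<N
                     (≤∧≢⇒< j≤δ j≢δ) (subst (δ x y <_) (+-suc j r) δ<j+r)

  dist≡δ : ∀ {x y} → x < N G → y < N G → dist G x y ≡ δ x y
  dist≡δ x<N y<N = firstReach≡δ (N G) 0 id (λ _ → refl) x<N y<N z≤n (δ<N x<N y<N)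

  trans≡∑δ : ∀ {x} → x < N G → trans G x ≡ ∑ (N G) (δ x)
  trans≡∑δ {x} x<N = ≡.trans (sum-map-applyUpTo (N G) (dist G x) id) (∑-cong (N G) (λ y y<N → dist≡δ x<N y<N))

  diam≤ : ∀ B → (∀ {x y} → x < N G → y < N G → δ x y ≤ B) → diam G ≤ B
  diam≤ B δ≤B = max-map-applyUpTo-≤ (N G) _ id (λ x x<N →
    max-map-applyUpTo-≤ (N G) (dist G x) id (λ y y<N → subst (_≤ B) (sym (dist≡δ x<N y<N)) (δ≤B x<N y<N)))

  δ≤diam : ∀ {x y} → x < N G → y < N G → δ x y ≤ diam G
  δ≤diam {x} {y} x<N y<N = begin
    δ x y                                        ≡⟨ sym (dist≡δ x<N y<N) ⟩
    dist G x y                                   ≤⟨ ≤-max-map-applyUpTo (N G) (dist G x) id y<N ⟩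
    foldr _⊔_ 0 (map (dist G x) (upTo (N G)))    ≤⟨ ≤-max-map-applyUpTo (N G) _ id x<N ⟩
    diam G                                       ∎
    where open ≤-Reasoning

-- Distances on a cycle

∣m-1+n∣≤1+∣m-n∣ : ∀ m n → ∣ m - suc n ∣ ≤ suc ∣ m - n ∣
∣m-1+n∣≤1+∣m-n∣ zero    n       = ≤-refl
∣m-1+n∣≤1+∣m-n∣ (suc m) zero    = ≤-trans (≤-reflexive (∣-∣-identityʳ m)) (≤-trans (n≤1+n m) (n≤1+n _))
∣m-1+n∣≤1+∣m-n∣ (suc m) (suc n) = ∣m-1+n∣≤1+∣m-n∣ m n

∣m-n∣≤1+∣m-1+n∣ : ∀ m n → ∣ m - n ∣ ≤ suc ∣ m - suc n ∣
∣m-n∣≤1+∣m-1+n∣ zero    n       = ≤-trans (n≤1+n n) (n≤1+n _)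
∣m-n∣≤1+∣m-1+n∣ (suc m) zero    = s≤s (≤-reflexive (sym (∣-∣-identityʳ m)))
∣m-n∣≤1+∣m-1+n∣ (suc m) (suc n) = ∣m-n∣≤1+∣m-1+n∣ m n

m∸n≤1+m∸o : ∀ m {n o} → o ≤ suc n → m ∸ n ≤ suc (m ∸ o)
m∸n≤1+m∸o zero    {n} {o} _ = subst (_≤ suc (0 ∸ o)) (sym (0∸n≡0 n)) z≤n
m∸n≤1+m∸o (suc m) {zero}  {zero}        _         = n≤1+n _
m∸n≤1+m∸o (suc m) {zero}  {suc zero}    _         = ≤-refl
m∸n≤1+m∸o (suc m) {zero}  {suc (suc o)} (s≤s ())
m∸n≤1+m∸o (suc m) {suc n} {zero}        _         = ≤-trans (m∸n≤m m n) (≤-trans (n≤1+n m) (n≤1+n _))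
m∸n≤1+m∸o (suc m) {suc n} {suc o}       (s≤s o≤n) = m∸n≤1+m∸o m o≤n

∣m+n-m∣≡n : ∀ m n → ∣ m + n - m ∣ ≡ n
∣m+n-m∣≡n m n = ≡.trans (∣-∣-comm (m + n) m) (∣m-m+n∣≡n m n)

m≡n+o⇒m∸o≡n : ∀ {m n o} → m ≡ n + o → m ∸ o ≡ n
m≡n+o⇒m∸o≡n {n = n} {o} refl = m+n∸n≡m n o

cycleDist : ℕ → ℕ → ℕ → ℕ
cycleDist M i j = ∣ i - j ∣ ⊓ (M ∸ ∣ i - j ∣)

cycleDist-≡ : ∀ M x y {u v} → ∣ x - y ∣ ≡ u → M ∸ u ≡ v → cycleDist M x y ≡ u ⊓ v
cycleDist-≡ M x y refl refl = refl

cycleDist-comm : ∀ M i j → cycleDist M i j ≡ cycleDist M j i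
cycleDist-comm M i j rewrite ∣-∣-comm i j = refl

cycleDist-self : ∀ M i → cycleDist M i i ≡ 0
cycleDist-self M i rewrite ∣n-n∣≡0 i = refl

cycleDist≤∣-∣ : ∀ M i j → cycleDist M i j ≤ ∣ i - j ∣
cycleDist≤∣-∣ M i j = m⊓n≤m _ _

cycleDist≤half : ∀ {M} K i j → M ≤ suc (K + K) → cycleDist M i j ≤ K
cycleDist≤half {M} K i j M≤2K+1 with ∣ i - j ∣ ≤? K
... | yes ∣i-j∣≤K = ≤-trans (m⊓n≤m _ _) ∣i-j∣≤K
... | no  ∣i-j∣≰K = begin
  cycleDist M i j           ≤⟨ m⊓n≤n _ _ ⟩
  M ∸ ∣ i - j ∣             ≤⟨ ∸-monoˡ-≤ ∣ i - j ∣ M≤2K+1 ⟩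
  suc (K + K) ∸ ∣ i - j ∣   ≤⟨ ∸-monoʳ-≤ (suc (K + K)) (≰⇒> ∣i-j∣≰K) ⟩
  suc (K + K) ∸ suc K       ≡⟨ m+n∸m≡n K K ⟩
  K                         ∎
  where open ≤-Reasoning

cycleDist-0-≤half : ∀ {M} j → j + j ≤ M → cycleDist M 0 j ≡ j
cycleDist-0-≤half j 2j≤M = m≤n⇒m⊓n≡m (m+n≤o⇒m≤o∸n j 2j≤M)

cycleDist≡0⇒≡ : ∀ M {x y} → x < M → y < M → cycleDist M x y ≡ 0 → x ≡ y
cycleDist≡0⇒≡ M {x} {y} x<M y<M d≡0 with ⊓-sel ∣ x - y ∣ (M ∸ ∣ x - y ∣)
... | inj₁ d≡∣x-y∣ = ∣m-n∣≡0⇒m≡n (≡.trans (sym d≡∣x-y∣) d≡0)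
... | inj₂ d≡M∸∣x-y∣ = ⊥-elim (m>n⇒m∸n≢0 ∣x-y∣<M (≡.trans (sym d≡M∸∣x-y∣) d≡0))
  where
  ∣x-y∣<M : ∣ x - y ∣ < M
  ∣x-y∣<M = ≤-<-trans (∣m-n∣≤m⊔n x y) (⊔-lub x<M y<M)

cycleDist-suc-≤ : ∀ M x i → cycleDist M x (suc i) ≤ suc (cycleDist M x i)
cycleDist-suc-≤ M x i = ⊓-mono-≤ (∣m-1+n∣≤1+∣m-n∣ x i) (m∸n≤1+m∸o M (∣m-n∣≤1+∣m-1+n∣ x i))

cycleDist-≤-suc : ∀ M x i → cycleDist M x i ≤ suc (cycleDist M x (suc i))
cycleDist-≤-suc M x i = ⊓-mono-≤ (∣m-n∣≤1+∣m-1+n∣ x i) (m∸n≤1+m∸o M (∣m-1+n∣≤1+∣m-n∣ x i))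

cycleDist-wrap-≤ : ∀ m₁ {x} → x ≤ m₁ →
                   cycleDist (suc m₁) x 0 ≤ suc (cycleDist (suc m₁) x m₁) ×
                   cycleDist (suc m₁) x m₁ ≤ suc (cycleDist (suc m₁) x 0)
cycleDist-wrap-≤ m₁ {x} x≤m₁
  rewrite m≤n⇒∣m-n∣≡n∸m x≤m₁ | +-∸-assoc 1 (m∸n≤m m₁ x) | m∸[m∸n]≡n x≤m₁
        | ∣-∣-identityʳ x | +-∸-assoc 1 x≤m₁ =
    subst (λ w → x ⊓ suc (m₁ ∸ x) ≤ suc w) (⊓-comm (suc x) (m₁ ∸ x))
      (⊓-mono-≤ (≤-trans (n≤1+n x) (n≤1+n _)) ≤-refl)
  , subst (λ w → (m₁ ∸ x) ⊓ suc x ≤ suc w) (⊓-comm (suc (m₁ ∸ x)) x)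
      (⊓-mono-≤ (≤-trans (n≤1+n _) (n≤1+n _)) ≤-refl)

CycleAdj : ℕ → ℕ → ℕ → Set
CycleAdj m₁ z y = (∃[ i ] i < m₁ × z ≡ i × y ≡ suc i) ⊎ (∃[ i ] i < m₁ × y ≡ i × z ≡ suc i)
                ⊎ (z ≡ m₁ × y ≡ 0) ⊎ (y ≡ m₁ × z ≡ 0)

HasPredecessor : ℕ → ℕ → ℕ → Set
HasPredecessor m₁ x y =
  ∃[ z ] z ≤ m₁ × CycleAdj m₁ z y × suc (cycleDist (suc m₁) x z) ≡ cycleDist (suc m₁) x y

private
  ∣m-1+m+n∣≡1+n : ∀ m n → ∣ m - suc (m + n) ∣ ≡ suc n
  ∣m-1+m+n∣≡1+n m n = ≡.trans (cong (∣ m -_∣) (sym (+-suc m n))) (∣m-m+n∣≡n m (suc n))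

  1+m≤m+1+n : ∀ m n → suc m ≤ m + suc n
  1+m≤m+1+n m n = subst (suc m ≤_) (sym (+-suc m n)) (s≤s (m≤m+n m n))

  ≤2+ : ∀ {m n} → m ≤ n → m ≤ suc (suc n)
  ≤2+ m≤n = ≤-trans m≤n (≤-trans (n≤1+n _) (n≤1+n _))

  len₁ : ∀ x d r → suc (suc (x + d) + r) ≡ suc (x + r) + suc d
  len₁ = solve-∀
  len₂ : ∀ x d r → suc (suc (x + d) + r) ≡ suc (suc (x + r)) + d
  len₂ = solve-∀
  len₃ : ∀ x d r → suc (suc (x + d) + suc r) ≡ suc (x + r) + suc (suc d)
  len₃ = solve-∀
  len₄ : ∀ x d → suc (suc (x + d) + 0) ≡ suc (suc d) + x
  len₄ = solve-∀
  len₅ : ∀ y d r → suc (suc (suc y + d) + r) ≡ suc (y + r) + suc (suc d)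
  len₅ = solve-∀
  len₆ : ∀ d r → suc (suc (0 + d) + r) ≡ suc (suc d) + r
  len₆ = solve-∀

  -- y = x + d + 1 lies on the cycle of length x + d + r + 2; the two arcs have lengths d + 1 and x + r + 1.
  cycleDist-forward : ∀ x d r → cycleDist (suc (suc (x + d) + r)) x (suc (x + d)) ≡ suc d ⊓ suc (x + r)
  cycleDist-forward x d r = cycleDist-≡ _ x (suc (x + d)) (∣m-1+m+n∣≡1+n x d) (m≡n+o⇒m∸o≡n (len₁ x d r))

  cycleDist-backward : ∀ y d r → cycleDist (suc (suc (y + d) + r)) (suc (y + d)) y ≡ suc d ⊓ suc (y + r)
  cycleDist-backward y d r =
    cycleDist-≡ _ (suc (y + d)) y (≡.trans (∣-∣-comm (suc (y + d)) y) (∣m-1+m+n∣≡1+n y d)) (m≡n+o⇒m∸o≡n (len₁ y d r))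

  forward-direct : ∀ x d r → suc d ≤ suc (x + r) → HasPredecessor (suc (x + d) + r) x (suc (x + d))
  forward-direct x d r d<arc =
      x + d , ≤-trans (n≤1+n _) (m≤m+n _ r) , inj₁ (x + d , m≤m+n _ r , refl , refl)
    , ≡.trans (cong suc (≡.trans (cycleDist-≡ _ x (x + d) (∣m-m+n∣≡n x d) (m≡n+o⇒m∸o≡n (len₂ x d r)))
                                  (m≤n⇒m⊓n≡m (≤2+ (≤-pred d<arc)))))
              (sym (≡.trans (cycleDist-forward x d r) (m≤n⇒m⊓n≡m d<arc)))

  forward-wrap : ∀ x d r → suc (x + suc r) < suc d → HasPredecessor (suc (x + d) + suc r) x (suc (x + d))
  forward-wrap x d r arc<d =
      suc (suc (x + d)) , 1+m≤m+1+n _ r , inj₂ (inj₁ (suc (x + d) , 1+m≤m+1+n _ r , refl , refl))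
    , ≡.trans (cong suc (≡.trans (cycleDist-≡ _ x (suc (suc (x + d))) (≡.trans (cong (λ w → ∣ x - suc w ∣) (sym (+-suc x d)))
                                                                (∣m-1+m+n∣≡1+n x (suc d)))
                                                       (m≡n+o⇒m∸o≡n (len₃ x d r)))
                                  (m≥n⇒m⊓n≡n (≤-trans (≤-reflexive (sym (+-suc x r)))
                                                      (≤-trans (n≤1+n _) (≤2+ (≤-pred arc<d)))))))
              (≡.trans (cong suc (sym (+-suc x r)))
                       (sym (≡.trans (cycleDist-forward x d (suc r)) (m≥n⇒m⊓n≡n (≤-trans (n≤1+n _) arc<d)))))

  forward-last : ∀ x d → suc (x + 0) < suc d → HasPredecessor (suc (x + d) + 0) x (suc (x + d))
  forward-last x d arc<d =
      0 , z≤n , inj₂ (inj₂ (inj₂ (sym (+-identityʳ _) , refl)))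
    , ≡.trans (cong suc (≡.trans (cycleDist-≡ _ x 0 (∣-∣-identityʳ x) (m≡n+o⇒m∸o≡n (len₄ x d)))
                                  (m≤n⇒m⊓n≡m (≤-trans (m≤m+n x 0) (≤-trans (n≤1+n _) (≤2+ (≤-pred arc<d)))))))
              (≡.trans (cong suc (sym (+-identityʳ x)))
                       (sym (≡.trans (cycleDist-forward x d 0) (m≥n⇒m⊓n≡n (≤-trans (n≤1+n _) arc<d)))))

  backward-direct : ∀ y d r → suc d ≤ suc (y + r) → HasPredecessor (suc (y + d) + r) (suc (y + d)) y
  backward-direct y d r d<arc =
      suc y , ≤-trans (s≤s (m≤m+n y d)) (m≤m+n _ r) , inj₂ (inj₁ (y , ≤-trans (s≤s (m≤m+n y d)) (m≤m+n _ r) , refl , refl))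
    , ≡.trans (cong suc (≡.trans (cycleDist-≡ _ (suc (y + d)) (suc y) (∣m+n-m∣≡n y d) (m≡n+o⇒m∸o≡n (len₂ y d r)))
                                  (m≤n⇒m⊓n≡m (≤2+ (≤-pred d<arc)))))
              (sym (≡.trans (cycleDist-backward y d r) (m≤n⇒m⊓n≡m d<arc)))

  backward-wrap : ∀ y d r → suc (suc y + r) < suc d → HasPredecessor (suc (suc y + d) + r) (suc (suc y + d)) (suc y)
  backward-wrap y d r arc<d =
      y , ≤-trans (n≤1+n y) y<m₁ , inj₁ (y , y<m₁ , refl , refl)
    , ≡.trans (cong suc (≡.trans (cycleDist-≡ _ (suc (suc y + d)) y (≡.trans (cong (λ w → ∣ w - y ∣) (≡.trans (cong suc (sym (+-suc y d)))
                                                                                           (sym (+-suc y (suc d)))))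
                                                                (∣m+n-m∣≡n y (suc (suc d))))
                                                       (m≡n+o⇒m∸o≡n (len₅ y d r)))
                                  (m≥n⇒m⊓n≡n (≤-trans (n≤1+n _) (≤2+ (≤-pred arc<d))))))
              (sym (≡.trans (cycleDist-backward (suc y) d r) (m≥n⇒m⊓n≡n (≤-trans (n≤1+n _) arc<d))))
    where
    y<m₁ : y < suc (suc y + d) + r
    y<m₁ = ≤-trans (s≤s (m≤m+n y d)) (≤-trans (n≤1+n _) (m≤m+n _ r))

  backward-first : ∀ d r → suc (0 + r) < suc d → HasPredecessor (suc (0 + d) + r) (suc (0 + d)) 0
  backward-first d r arc<d =
      suc (d + r) , ≤-refl , inj₂ (inj₂ (inj₁ (refl , refl)))
    , ≡.trans (cong suc (≡.trans (cycleDist-≡ _ (suc d) (suc (d + r)) (∣m-m+n∣≡n d r) (m≡n+o⇒m∸o≡n (len₆ d r)))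
                                  (m≤n⇒m⊓n≡m (≤-trans (n≤1+n _) (≤2+ (≤-pred arc<d))))))
              (sym (≡.trans (cycleDist-backward 0 d r) (m≥n⇒m⊓n≡n (≤-trans (n≤1+n _) arc<d))))

cycleDist-predecessor : ∀ m₁ {x y} → x ≤ m₁ → y ≤ m₁ → 0 < cycleDist (suc m₁) x y → HasPredecessor m₁ x y
cycleDist-predecessor m₁ {x} {y} x≤m₁ y≤m₁ 0<d with <-cmp x y
... | tri≈ _ refl _ = ⊥-elim (<-irrefl (sym (cycleDist-self (suc m₁) x)) 0<d)
... | tri< x<y _ _ with m≤n⇒∃[o]m+o≡n x<y | m≤n⇒∃[o]m+o≡n y≤m₁
...   | d , refl | r , refl with suc d ≤? suc (x + r)
...     | yes d<arc = forward-direct x d r d<arc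
cycleDist-predecessor m₁ {x} x≤m₁ y≤m₁ 0<d | tri< _ _ _ | d , refl | suc r , refl | no d≮arc =
  forward-wrap x d r (≰⇒> d≮arc)
cycleDist-predecessor m₁ {x} x≤m₁ y≤m₁ 0<d | tri< _ _ _ | d , refl | zero , refl | no d≮arc =
  forward-last x d (≰⇒> d≮arc)
cycleDist-predecessor m₁ {x} {y} x≤m₁ y≤m₁ 0<d | tri> _ _ y<x with m≤n⇒∃[o]m+o≡n y<x | m≤n⇒∃[o]m+o≡n x≤m₁
... | d , refl | r , refl with suc d ≤? suc (y + r)
...   | yes d<arc = backward-direct y d r d<arc
cycleDist-predecessor m₁ {_} {suc y} x≤m₁ y≤m₁ 0<d | tri> _ _ _ | d , refl | r , refl | no d≮arc =
  backward-wrap y d r (≰⇒> d≮arc)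
cycleDist-predecessor m₁ {_} {zero} x≤m₁ y≤m₁ 0<d | tri> _ _ _ | d , refl | r , refl | no d≮arc =
  backward-first d r (≰⇒> d≮arc)


cycleDist-rotate : ∀ i k {j} → j ≤ i → cycleDist (i + k) i j ≡ cycleDist (i + k) 0 (k + j)
cycleDist-rotate i k {j} j≤i with m≤n⇒∃[o]m+o≡n j≤i
... | d , refl = begin
  cycleDist (j + d + k) (j + d) j   ≡⟨ cycleDist-≡ _ (j + d) j (∣m+n-m∣≡n j d) (m≡n+o⇒m∸o≡n (e₁ j d k)) ⟩
  d ⊓ (j + k)                       ≡⟨ ⊓-comm d (j + k) ⟩
  (j + k) ⊓ d                       ≡⟨ cong (_⊓ d) (+-comm j k) ⟩
  (k + j) ⊓ d                       ≡⟨ sym (cycleDist-≡ _ 0 (k + j) refl (m≡n+o⇒m∸o≡n (e₂ j d k))) ⟩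
  cycleDist (j + d + k) 0 (k + j)   ∎
  where
  open ≡-Reasoning
  e₁ : ∀ j d k → j + d + k ≡ (j + k) + d
  e₁ = solve-∀
  e₂ : ∀ j d k → j + d + k ≡ d + (k + j)
  e₂ = solve-∀

cycleTrans : ℕ → ℕ
cycleTrans M = ∑ M (cycleDist M 0)

∑-cycleDist-rotate : ∀ {M i} → i < M → ∑ M (cycleDist M i) ≡ cycleTrans M
∑-cycleDist-rotate {M} {i} i<M = subst (λ M → ∑ M (cycleDist M i) ≡ cycleTrans M) (m+[n∸m]≡n (<⇒≤ i<M)) (rotated (M ∸ i))
  where
  open ≡-Reasoning
  rotated : ∀ k → ∑ (i + k) (cycleDist (i + k) i) ≡ cycleTrans (i + k)
  rotated k = begin
    ∑ (i + k) (cycleDist M′ i)                                     ≡⟨ ∑-+ i k _ ⟩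
    ∑ i (cycleDist M′ i) + ∑[ t < k ] cycleDist M′ i (i + t)       ≡⟨ cong₂ _+_
        (∑-cong i (λ j j<i → cycleDist-rotate i k (<⇒≤ j<i)))
        (∑-cong k (λ t _ → cong (λ w → w ⊓ (M′ ∸ w)) (∣m-m+n∣≡n i t))) ⟩
    ∑[ j < i ] cycleDist M′ 0 (k + j) + ∑ k (cycleDist M′ 0)       ≡⟨ +-comm _ (∑ k (cycleDist M′ 0)) ⟩
    ∑ k (cycleDist M′ 0) + ∑[ j < i ] cycleDist M′ 0 (k + j)       ≡⟨ sym (∑-+ k i _) ⟩
    ∑ (k + i) (cycleDist M′ 0)                                     ≡⟨ cong (λ w → ∑ w (cycleDist M′ 0)) (+-comm k i) ⟩
    cycleTrans M′                                                  ∎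
    where M′ = i + k

2*∑id+n≡n*n : ∀ n → 2 * ∑ n id + n ≡ n * n
2*∑id+n≡n*n zero    = refl
2*∑id+n≡n*n (suc n) = begin
  2 * ∑ (suc n) id + suc n          ≡⟨ cong (λ s → 2 * s + suc n) (∑-suc n id) ⟩
  2 * (∑ n id + n) + suc n          ≡⟨ e₁ (∑ n id) n ⟩
  (2 * ∑ n id + n) + 2 * n + 1      ≡⟨ cong (λ w → w + 2 * n + 1) (2*∑id+n≡n*n n) ⟩
  n * n + 2 * n + 1                 ≡⟨ e₂ n ⟩
  suc n * suc n                     ∎
  where
  open ≡-Reasoning
  e₁ : ∀ s n → 2 * (s + n) + suc n ≡ (2 * s + n) + 2 * n + 1
  e₁ = solve-∀
  e₂ : ∀ n → n * n + 2 * n + 1 ≡ suc n * suc n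
  e₂ = solve-∀

2*∑[n∸i]≡n*[1+n] : ∀ n → 2 * ∑[ i < n ] (n ∸ i) ≡ n * suc n
2*∑[n∸i]≡n*[1+n] zero    = refl
2*∑[n∸i]≡n*[1+n] (suc n) = begin
  2 * (suc n + ∑[ i < n ] (n ∸ i))   ≡⟨ *-distribˡ-+ 2 (suc n) _ ⟩
  2 * suc n + 2 * ∑[ i < n ] (n ∸ i) ≡⟨ cong (2 * suc n +_) (2*∑[n∸i]≡n*[1+n] n) ⟩
  2 * suc n + n * suc n              ≡⟨ e n ⟩
  suc n * suc (suc n)                ∎
  where
  open ≡-Reasoning
  e : ∀ n → 2 * suc n + n * suc n ≡ suc n * suc (suc n)
  e = solve-∀

-- On a cycle of length L + K with K ≤ L ≤ K + 1 the vertices 0,…,L-1 lie on the near half of the cycle from 0.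
cycleTrans-halves : ∀ L K → K ≤ L → L ≤ suc K → cycleTrans (L + K) ≡ ∑ L id + ∑[ j < K ] (K ∸ j)
cycleTrans-halves L K K≤L L≤1+K = begin
  ∑ (L + K) (cycleDist (L + K) 0)                                ≡⟨ ∑-+ L K _ ⟩
  ∑ L (cycleDist (L + K) 0) + ∑[ j < K ] cycleDist (L + K) 0 (L + j)
    ≡⟨ cong₂ _+_ (∑-cong L (λ j j<L → cycleDist-0-≤half j (2j≤L+K j<L))) (∑-cong K (λ j _ → far j)) ⟩
  ∑ L id + ∑[ j < K ] (K ∸ j)                                    ∎
  where
  open ≡-Reasoning
  2j≤L+K : ∀ {j} → j < L → j + j ≤ L + K
  2j≤L+K j<L = +-mono-≤ (<⇒≤ j<L) (≤-pred (≤-trans j<L L≤1+K))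
  far : ∀ j → cycleDist (L + K) 0 (L + j) ≡ K ∸ j
  far j = ≡.trans (cong ((L + j) ⊓_) ([m+n]∸[m+o]≡n∸o L K j))
                  (m≥n⇒m⊓n≡n (≤-trans (m∸n≤m K j) (≤-trans K≤L (m≤m+n L j))))

cycleTrans-even : ∀ K → cycleTrans (K + K) ≡ K * K
cycleTrans-even K = *-cancelˡ-≡ _ _ 2 (+-cancelʳ-≡ K _ _ (begin
  2 * cycleTrans (K + K) + K                               ≡⟨ cong (λ s → 2 * s + K) (cycleTrans-halves K K ≤-refl (n≤1+n K)) ⟩
  2 * (∑ K id + ∑[ j < K ] (K ∸ j)) + K                    ≡⟨ e₁ (∑ K id) (∑[ j < K ] (K ∸ j)) K ⟩
  (2 * ∑ K id + K) + 2 * ∑[ j < K ] (K ∸ j)                ≡⟨ cong₂ _+_ (2*∑id+n≡n*n K) (2*∑[n∸i]≡n*[1+n] K) ⟩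
  K * K + K * suc K                                        ≡⟨ e₂ K ⟩
  2 * (K * K) + K                                          ∎))
  where
  open ≡-Reasoning
  e₁ : ∀ s r K → 2 * (s + r) + K ≡ (2 * s + K) + 2 * r
  e₁ = solve-∀
  e₂ : ∀ K → K * K + K * suc K ≡ 2 * (K * K) + K
  e₂ = solve-∀

cycleTrans-odd : ∀ K → cycleTrans (suc (K + K)) ≡ K * K + K
cycleTrans-odd K = *-cancelˡ-≡ _ _ 2 (+-cancelʳ-≡ (suc K) _ _ (begin
  2 * cycleTrans (suc K + K) + suc K                       ≡⟨ cong (λ s → 2 * s + suc K) (cycleTrans-halves (suc K) K (n≤1+n K) ≤-refl) ⟩
  2 * (∑ (suc K) id + ∑[ j < K ] (K ∸ j)) + suc K          ≡⟨ e₁ (∑ (suc K) id) (∑[ j < K ] (K ∸ j)) (suc K) ⟩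
  (2 * ∑ (suc K) id + suc K) + 2 * ∑[ j < K ] (K ∸ j)      ≡⟨ cong₂ _+_ (2*∑id+n≡n*n (suc K)) (2*∑[n∸i]≡n*[1+n] K) ⟩
  suc K * suc K + K * suc K                                ≡⟨ e₂ K ⟩
  2 * (K * K + K) + suc K                                  ∎))
  where
  open ≡-Reasoning
  e₁ : ∀ s r K → 2 * (s + r) + K ≡ (2 * s + K) + 2 * r
  e₁ = solve-∀
  e₂ : ∀ K → suc K * suc K + K * suc K ≡ 2 * (K * K + K) + suc K
  e₂ = solve-∀

even⊎odd : ∀ m → ∃[ K ] (m ≡ K + K ⊎ m ≡ suc (K + K))
even⊎odd zero    = 0 , inj₁ refl
even⊎odd (suc m) with even⊎odd m
... | K , inj₁ refl = K , inj₂ refl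
... | K , inj₂ refl = suc K , inj₁ (cong suc (sym (+-suc K K)))

cycleTrans-+2 : ∀ m → cycleTrans (2 + m) ≡ cycleTrans m + suc m
cycleTrans-+2 m with even⊎odd m
... | K , inj₁ refl = begin
  cycleTrans (2 + (K + K))        ≡⟨ cong cycleTrans (cong suc (sym (+-suc K K))) ⟩
  cycleTrans (suc K + suc K)      ≡⟨ cycleTrans-even (suc K) ⟩
  suc K * suc K                   ≡⟨ e K ⟩
  K * K + suc (K + K)             ≡⟨ cong (_+ suc (K + K)) (sym (cycleTrans-even K)) ⟩
  cycleTrans (K + K) + suc (K + K) ∎
  where
  open ≡-Reasoning
  e : ∀ K → suc K * suc K ≡ K * K + suc (K + K)
  e = solve-∀
... | K , inj₂ refl = begin
  cycleTrans (2 + suc (K + K))    ≡⟨ cong cycleTrans (cong (suc ∘ suc) (sym (+-suc K K))) ⟩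
  cycleTrans (suc (suc K + suc K)) ≡⟨ cycleTrans-odd (suc K) ⟩
  suc K * suc K + suc K           ≡⟨ e K ⟩
  (K * K + K) + suc (suc (K + K)) ≡⟨ cong (_+ suc (suc (K + K))) (sym (cycleTrans-odd K)) ⟩
  cycleTrans (suc (K + K)) + suc (suc (K + K)) ∎
  where
  open ≡-Reasoning
  e : ∀ K → suc K * suc K + suc K ≡ (K * K + K) + suc (suc (K + K))
  e = solve-∀

cycleTrans≤square : ∀ m → cycleTrans m ≤ m * m
cycleTrans≤square m = begin
  cycleTrans m      ≤⟨ ∑-mono-≤ m (λ j j<m → ≤-trans (cycleDist≤∣-∣ m 0 j) (<⇒≤ j<m)) ⟩
  ∑[ _ < m ] m      ≡⟨ ∑-const m m ⟩
  m * m             ∎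
  where open ≤-Reasoning

2*∑suc≡n*[1+n] : ∀ n → 2 * ∑ n suc ≡ n * suc n
2*∑suc≡n*[1+n] zero    = refl
2*∑suc≡n*[1+n] (suc n) = begin
  2 * ∑ (suc n) suc          ≡⟨ cong (2 *_) (∑-suc n suc) ⟩
  2 * (∑ n suc + suc n)      ≡⟨ *-distribˡ-+ 2 (∑ n suc) (suc n) ⟩
  2 * ∑ n suc + 2 * suc n    ≡⟨ cong (_+ 2 * suc n) (2*∑suc≡n*[1+n] n) ⟩
  n * suc n + 2 * suc n      ≡⟨ e n ⟩
  suc n * suc (suc n)        ∎
  where
  open ≡-Reasoning
  e : ∀ n → n * suc n + 2 * suc n ≡ suc n * suc (suc n)
  e = solve-∀

2*∑∣n-t∣≡n*[1+n] : ∀ n → 2 * ∑[ t < suc n ] ∣ n - t ∣ ≡ n * suc n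
2*∑∣n-t∣≡n*[1+n] zero    = refl
2*∑∣n-t∣≡n*[1+n] (suc n) = begin
  2 * (suc n + ∑[ t < suc n ] ∣ n - t ∣)    ≡⟨ *-distribˡ-+ 2 (suc n) _ ⟩
  2 * suc n + 2 * ∑[ t < suc n ] ∣ n - t ∣  ≡⟨ cong (2 * suc n +_) (2*∑∣n-t∣≡n*[1+n] n) ⟩
  2 * suc n + n * suc n                     ≡⟨ e n ⟩
  suc n * suc (suc n)                       ∎
  where
  open ≡-Reasoning
  e : ∀ n → 2 * suc n + n * suc n ≡ suc n * suc (suc n)
  e = solve-∀

∑∑∣s-t∣ : ℕ → ℕ
∑∑∣s-t∣ n = ∑[ s < n ] ∑[ t < n ] ∣ s - t ∣

∑∑∣s-t∣-suc : ∀ n → ∑∑∣s-t∣ (suc n) ≡ ∑∑∣s-t∣ n + 2 * ∑[ t < suc n ] ∣ n - t ∣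
∑∑∣s-t∣-suc n = begin
  ∑[ s < suc n ] ∑[ t < suc n ] ∣ s - t ∣
    ≡⟨ ∑-suc n _ ⟩
  ∑[ s < n ] ∑[ t < suc n ] ∣ s - t ∣ + R
    ≡⟨ cong (_+ R) (∑-cong n (λ s _ → ∑-suc n (λ t → ∣ s - t ∣))) ⟩
  ∑[ s < n ] (∑[ t < n ] ∣ s - t ∣ + ∣ s - n ∣) + R
    ≡⟨ cong (_+ R) (∑-distrib-+ n _ _) ⟩
  ∑∑∣s-t∣ n + ∑[ s < n ] ∣ s - n ∣ + R
    ≡⟨ cong (λ w → ∑∑∣s-t∣ n + w + R) column≡row ⟩
  ∑∑∣s-t∣ n + R + R
    ≡⟨ e (∑∑∣s-t∣ n) R ⟩
  ∑∑∣s-t∣ n + 2 * R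
    ∎
  where
  open ≡-Reasoning
  R = ∑[ t < suc n ] ∣ n - t ∣
  column≡row : ∑[ s < n ] ∣ s - n ∣ ≡ R
  column≡row = begin
    ∑[ s < n ] ∣ s - n ∣               ≡⟨ ∑-cong n (λ s _ → ∣-∣-comm s n) ⟩
    ∑[ t < n ] ∣ n - t ∣               ≡⟨ sym (+-identityʳ _) ⟩
    ∑[ t < n ] ∣ n - t ∣ + 0           ≡⟨ cong (∑[ t < n ] ∣ n - t ∣ +_) (sym (∣n-n∣≡0 n)) ⟩
    ∑[ t < n ] ∣ n - t ∣ + ∣ n - n ∣   ≡⟨ sym (∑-suc n (λ t → ∣ n - t ∣)) ⟩
    R                                  ∎
  e : ∀ p r → p + r + r ≡ p + 2 * r
  e = solve-∀

3*∑∑∣s-t∣+n≡n³ : ∀ n → 3 * ∑∑∣s-t∣ n + n ≡ n * n * n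
3*∑∑∣s-t∣+n≡n³ zero    = refl
3*∑∑∣s-t∣+n≡n³ (suc n) = begin
  3 * ∑∑∣s-t∣ (suc n) + suc n                      ≡⟨ cong (λ p → 3 * p + suc n) (∑∑∣s-t∣-suc n) ⟩
  3 * (∑∑∣s-t∣ n + 2 * R) + suc n                  ≡⟨ e₁ (∑∑∣s-t∣ n) (2 * R) n ⟩
  (3 * ∑∑∣s-t∣ n + n) + 3 * (2 * R) + 1            ≡⟨ cong₂ (λ u v → u + 3 * v + 1) (3*∑∑∣s-t∣+n≡n³ n) (2*∑∣n-t∣≡n*[1+n] n) ⟩
  n * n * n + 3 * (n * suc n) + 1                  ≡⟨ e₂ n ⟩
  suc n * suc n * suc n                            ∎
  where
  open ≡-Reasoning
  R = ∑[ t < suc n ] ∣ n - t ∣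
  e₁ : ∀ p r n → 3 * (p + r) + suc n ≡ (3 * p + n) + 3 * r + 1
  e₁ = solve-∀
  e₂ : ∀ n → n * n * n + 3 * (n * suc n) + 1 ≡ suc n * suc n * suc n
  e₂ = solve-∀

Joins : ℕ → ℕ → ℕ × ℕ → Set
Joins x y (p , q) = (p ≡ x × q ≡ y) ⊎ (p ≡ y × q ≡ x)

Joins-sym : ∀ {x y} e → Joins x y e → Joins y x e
Joins-sym _ (inj₁ (p≡x , q≡y)) = inj₂ (p≡x , q≡y)
Joins-sym _ (inj₂ (p≡y , q≡x)) = inj₁ (p≡y , q≡x)

≡ᵇ-pair⇒≡ : ∀ {p q x y} → T ((p ≡ᵇ x) ∧ (q ≡ᵇ y)) → p ≡ x × q ≡ y
≡ᵇ-pair⇒≡ {p} {q} {x} {y} t = let px , qy = Equivalence.to T-∧ t in ≡ᵇ⇒≡ p x px , ≡ᵇ⇒≡ q y qy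

≡⇒≡ᵇ-pair : ∀ {p q x y} → p ≡ x × q ≡ y → T ((p ≡ᵇ x) ∧ (q ≡ᵇ y))
≡⇒≡ᵇ-pair {p} {q} {x} {y} (p≡x , q≡y) = Equivalence.from T-∧ (≡⇒≡ᵇ p x p≡x , ≡⇒≡ᵇ q y q≡y)

adjOf⇒Joins : ∀ es {x y} → T (adjOf es x y) → Any (Joins x y) es
adjOf⇒Joins es t = Any.map (λ t′ → Data.Sum.map ≡ᵇ-pair⇒≡ ≡ᵇ-pair⇒≡ (Equivalence.to T-∨ t′)) (any⁻ _ es t)

Joins⇒adjOf : ∀ es {x y} → Any (Joins x y) es → T (adjOf es x y)
Joins⇒adjOf es j = any⁺ _ (Any.map (λ j′ → Equivalence.from T-∨ (Data.Sum.map ≡⇒≡ᵇ-pair ≡⇒≡ᵇ-pair j′)) j)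

-- The tadpole graph: a cycle with a path attached

tadpole : ℕ → ℕ → Graph
tadpole m a = record { N = m + a ; adj = adjOf (cycleEdges m ++ pathEdges 0 m a) }

module Tadpole (m₁ a₁ : ℕ) (2≤m₁ : 2 ≤ m₁) where

  m a : ℕ
  m = suc m₁
  a = suc a₁

  G : Graph
  G = tadpole m a

  data Edge (x y : ℕ) : Set where
    wrap  : x ≡ m₁ → y ≡ 0 → Edge x y
    cycle : ∀ i → i < m₁ → x ≡ i → y ≡ suc i → Edge x y
    stem  : x ≡ 0 → y ≡ m → Edge x y
    path  : ∀ i → i < a₁ → x ≡ m + i → y ≡ m + suc i → Edge x y

  Adj : ℕ → ℕ → Set
  Adj x y = Edge x y ⊎ Edge y x

  private
    fromJoins : ∀ {p q x y} → Edge p q → Joins x y (p , q) → Adj x y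
    fromJoins e (inj₁ (refl , refl)) = inj₁ e
    fromJoins e (inj₂ (refl , refl)) = inj₂ e

    ∈applyUpTo : ∀ {f g : ℕ → ℕ} {i n} → i < n → Any (Joins (f i) (g i)) (map (λ j → f j , g j) (upTo n))
    ∈applyUpTo i<n = map⁺ (applyUpTo⁺ id (inj₁ (refl , refl)) i<n)

    edge∈ : ∀ {x y} → Edge x y → Any (Joins x y) (cycleEdges m ++ pathEdges 0 m a)
    edge∈ (wrap refl refl)         = ++⁺ˡ {xs = cycleEdges m} (here (inj₁ (refl , refl)))
    edge∈ (cycle i i<m₁ refl refl) = ++⁺ˡ {xs = cycleEdges m} (there (∈applyUpTo i<m₁))
    edge∈ (stem refl refl)         = ++⁺ʳ (cycleEdges m) (here (inj₁ (refl , refl)))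
    edge∈ (path i i<a₁ refl refl)  = ++⁺ʳ (cycleEdges m) (there (∈applyUpTo i<a₁))

  adj⇒Adj : ∀ {x y} → T (adj G x y) → Adj x y
  adj⇒Adj t with ++⁻ (cycleEdges m) (adjOf⇒Joins _ t)
  ... | inj₁ (here j)  = fromJoins (wrap refl refl) j
  ... | inj₁ (there j) with applyUpTo⁻ id (map⁻ j)
  ...   | i , i<m₁ , j′ = fromJoins (cycle i i<m₁ refl refl) j′
  adj⇒Adj t | inj₂ (here j) = fromJoins (stem refl refl) j
  adj⇒Adj t | inj₂ (there j) with applyUpTo⁻ id (map⁻ j)
  ...   | i , i<a₁ , j′ = fromJoins (path i i<a₁ refl refl) j′

  Adj⇒adj : ∀ {x y} → Adj x y → T (adj G x y)
  Adj⇒adj (inj₁ e) = Joins⇒adjOf _ (edge∈ e)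
  Adj⇒adj (inj₂ e) = Joins⇒adjOf _ (Any.map (λ {e} → Joins-sym e) (edge∈ e))

  cyc : ℕ → ℕ → ℕ
  cyc = cycleDist m

  -- Every shortest path between the cycle and the path runs through vertex 0.
  δ : ℕ → ℕ → ℕ
  δ x y with x <? m | y <? m
  ... | yes _ | yes _ = cyc x y
  ... | yes _ | no  _ = cyc 0 x + suc (y ∸ m)
  ... | no  _ | yes _ = cyc 0 y + suc (x ∸ m)
  ... | no  _ | no  _ = ∣ x - y ∣

  δ-cycle : ∀ {x y} → x < m → y < m → δ x y ≡ cyc x y
  δ-cycle {x} {y} x<m y<m with x <? m | y <? m
  ... | yes _   | yes _   = refl
  ... | no  x≮m | _       = ⊥-elim (x≮m x<m)
  ... | yes _   | no  y≮m = ⊥-elim (y≮m y<m)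

  private
    δ-cycle-path′ : ∀ {x y} → x < m → m ≤ y → δ x y ≡ cyc 0 x + suc (y ∸ m)
    δ-cycle-path′ {x} {y} x<m m≤y with x <? m | y <? m
    ... | yes _   | no  _   = refl
    ... | no  x≮m | _       = ⊥-elim (x≮m x<m)
    ... | yes _   | yes y<m = ⊥-elim (<⇒≱ y<m m≤y)

    δ-path-cycle′ : ∀ {x y} → m ≤ x → y < m → δ x y ≡ cyc 0 y + suc (x ∸ m)
    δ-path-cycle′ {x} {y} m≤x y<m with x <? m | y <? m
    ... | no  _   | yes _   = refl
    ... | yes x<m | _       = ⊥-elim (<⇒≱ x<m m≤x)
    ... | no  _   | no  y≮m = ⊥-elim (y≮m y<m)

    δ-path′ : ∀ {x y} → m ≤ x → m ≤ y → δ x y ≡ ∣ x - y ∣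
    δ-path′ {x} {y} m≤x m≤y with x <? m | y <? m
    ... | no  _   | no  _   = refl
    ... | yes x<m | _       = ⊥-elim (<⇒≱ x<m m≤x)
    ... | no  _   | yes y<m = ⊥-elim (<⇒≱ y<m m≤y)

  δ-cycle-path : ∀ {x} s → x < m → δ x (m + s) ≡ cyc 0 x + suc s
  δ-cycle-path s x<m = ≡.trans (δ-cycle-path′ x<m (m≤m+n m s)) (cong (λ w → _ + suc w) (m+n∸m≡n m s))

  δ-path-cycle : ∀ s {y} → y < m → δ (m + s) y ≡ cyc 0 y + suc s
  δ-path-cycle s y<m = ≡.trans (δ-path-cycle′ (m≤m+n m s) y<m) (cong (λ w → _ + suc w) (m+n∸m≡n m s))

  δ-path : ∀ s t → δ (m + s) (m + t) ≡ ∣ s - t ∣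
  δ-path s t = ≡.trans (δ-path′ (m≤m+n m s) (m≤m+n m t)) (∣m+n-m+o∣≡∣n-o∣ m s t)

  δ-path-stem : ∀ s → δ (m + s) m ≡ s
  δ-path-stem s = ≡.trans (δ-path′ (m≤m+n m s) ≤-refl) (∣m+n-m∣≡n m s)

  δ-cycle-stem : ∀ {x} → x < m → δ x m ≡ suc (cyc x 0)
  δ-cycle-stem {x} x<m = begin
    δ x m                   ≡⟨ δ-cycle-path′ x<m ≤-refl ⟩
    cyc 0 x + suc (m ∸ m)   ≡⟨ cong (λ w → cyc 0 x + suc w) (n∸n≡0 m) ⟩
    cyc 0 x + 1             ≡⟨ +-comm _ 1 ⟩
    suc (cyc 0 x)           ≡⟨ cong suc (cycleDist-comm m 0 x) ⟩
    suc (cyc x 0)           ∎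
    where open ≡-Reasoning

  data Vertex (x : ℕ) : Set where
    onCycle : x < m → Vertex x
    onPath  : ∀ s → s < a → x ≡ m + s → Vertex x

  vertex : ∀ {x} → x < m + a → Vertex x
  vertex {x} x<m+a with x <? m
  ... | yes x<m = onCycle x<m
  ... | no  x≮m = onPath (x ∸ m) (+-cancelˡ-< m _ _ (subst (_< m + a) (sym m+[x∸m]≡x) x<m+a)) (sym m+[x∸m]≡x)
    where
    m+[x∸m]≡x : m + (x ∸ m) ≡ x
    m+[x∸m]≡x = m+[n∸m]≡n (≮⇒≥ x≮m)

  cycle<N : ∀ {z} → z ≤ m₁ → z < m + a
  cycle<N z≤m₁ = ≤-trans (s≤s z≤m₁) (m≤m+n m a)

  path<N : ∀ {s} → s < a → m + s < m + a
  path<N s<a = +-monoʳ-< m s<a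

  cyc-0-m₁ : cyc 0 m₁ ≡ 1
  cyc-0-m₁ = ≡.trans (cong (m₁ ⊓_) (≡.trans (+-∸-assoc 1 (≤-refl {m₁})) (cong suc (n∸n≡0 m₁))))
                     (m≥n⇒m⊓n≡n (≤-trans (s≤s z≤n) 2≤m₁))

  private
    ≤1+-resp : ∀ {u v u′ v′} → u ≡ u′ → v ≡ v′ → u′ ≤ suc v′ → u ≤ suc v
    ≤1+-resp refl refl h = h

  δ-edge-≤ : ∀ {x p q} → x < m + a → Edge p q → δ x q ≤ suc (δ x p) × δ x p ≤ suc (δ x q)
  δ-edge-≤ {x} x<N e with vertex x<N
  δ-edge-≤ {x} _ (cycle i i<m₁ refl refl) | onCycle x<m =
      ≤1+-resp (δ-cycle x<m (s≤s i<m₁)) (δ-cycle x<m (m<n⇒m<1+n i<m₁)) (cycleDist-suc-≤ m x i)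
    , ≤1+-resp (δ-cycle x<m (m<n⇒m<1+n i<m₁)) (δ-cycle x<m (s≤s i<m₁)) (cycleDist-≤-suc m x i)
  δ-edge-≤ {x} _ (wrap refl refl) | onCycle x<m =
      ≤1+-resp (δ-cycle x<m z<s) (δ-cycle x<m ≤-refl) (proj₁ (cycleDist-wrap-≤ m₁ (≤-pred x<m)))
    , ≤1+-resp (δ-cycle x<m ≤-refl) (δ-cycle x<m z<s) (proj₂ (cycleDist-wrap-≤ m₁ (≤-pred x<m)))
  δ-edge-≤ {x} _ (stem refl refl) | onCycle x<m =
      ≤1+-resp (δ-cycle-stem x<m) (δ-cycle x<m z<s) ≤-refl
    , ≤1+-resp (δ-cycle x<m z<s) (δ-cycle-stem x<m) (≤-trans (n≤1+n _) (n≤1+n _))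
  δ-edge-≤ {x} _ (path i i<a₁ refl refl) | onCycle x<m =
      ≤1+-resp (δ-cycle-path (suc i) x<m) (δ-cycle-path i x<m) (≤-reflexive (+-suc (cyc 0 x) (suc i)))
    , ≤1+-resp (δ-cycle-path i x<m) (δ-cycle-path (suc i) x<m) (≤-trans (+-monoʳ-≤ (cyc 0 x) (n≤1+n (suc i))) (n≤1+n _))
  δ-edge-≤ _ (cycle i i<m₁ refl refl) | onPath s _ refl =
      ≤1+-resp (δ-path-cycle s (s≤s i<m₁)) (δ-path-cycle s (m<n⇒m<1+n i<m₁)) (+-monoˡ-≤ (suc s) (cycleDist-suc-≤ m 0 i))
    , ≤1+-resp (δ-path-cycle s (m<n⇒m<1+n i<m₁)) (δ-path-cycle s (s≤s i<m₁)) (+-monoˡ-≤ (suc s) (cycleDist-≤-suc m 0 i))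
  δ-edge-≤ _ (wrap refl refl) | onPath s _ refl =
      ≤1+-resp (δ-path-cycle s z<s) (≡.trans (δ-path-cycle s ≤-refl) (cong (_+ suc s) cyc-0-m₁)) (≤-trans (n≤1+n _) (n≤1+n _))
    , ≤1+-resp (≡.trans (δ-path-cycle s ≤-refl) (cong (_+ suc s) cyc-0-m₁)) (δ-path-cycle s z<s) ≤-refl
  δ-edge-≤ _ (stem refl refl) | onPath s _ refl =
      ≤1+-resp (δ-path-stem s) (δ-path-cycle s z<s) (≤-trans (n≤1+n s) (n≤1+n _))
    , ≤1+-resp (δ-path-cycle s z<s) (δ-path-stem s) ≤-refl
  δ-edge-≤ _ (path i i<a₁ refl refl) | onPath s _ refl =
      ≤1+-resp (δ-path s (suc i)) (δ-path s i) (∣m-1+n∣≤1+∣m-n∣ s i)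
    , ≤1+-resp (δ-path s i) (δ-path s (suc i)) (∣m-n∣≤1+∣m-1+n∣ s i)

  private
    c+1+s≢0 : ∀ c s → c + suc s ≢ 0
    c+1+s≢0 c s c+1+s≡0 = 1+n≢0 (≡.trans (sym (+-suc c s)) c+1+s≡0)

    cycleAdj⇒Adj : ∀ {z y} → CycleAdj m₁ z y → Adj z y
    cycleAdj⇒Adj (inj₁ (i , i<m₁ , z≡i , y≡1+i))        = inj₁ (cycle i i<m₁ z≡i y≡1+i)
    cycleAdj⇒Adj (inj₂ (inj₁ (i , i<m₁ , y≡i , z≡1+i))) = inj₂ (cycle i i<m₁ y≡i z≡1+i)
    cycleAdj⇒Adj (inj₂ (inj₂ (inj₁ (z≡m₁ , y≡0))))      = inj₁ (wrap z≡m₁ y≡0)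
    cycleAdj⇒Adj (inj₂ (inj₂ (inj₂ (y≡m₁ , z≡0))))      = inj₂ (wrap y≡m₁ z≡0)

    ∣s-1+t∣≡1+∣s-t∣ : ∀ {s t} → s ≤ t → ∣ s - suc t ∣ ≡ suc ∣ s - t ∣
    ∣s-1+t∣≡1+∣s-t∣ s≤t rewrite m≤n⇒∣m-n∣≡n∸m s≤t | m≤n⇒∣m-n∣≡n∸m (m≤n⇒m≤1+n s≤t) = +-∸-assoc 1 s≤t

    ∣s-t∣≡1+∣s-1+t∣ : ∀ {s t} → t < s → ∣ s - t ∣ ≡ suc ∣ s - suc t ∣
    ∣s-t∣≡1+∣s-1+t∣ t<s rewrite m≤n⇒∣n-m∣≡n∸m t<s | m≤n⇒∣n-m∣≡n∸m (<⇒≤ t<s) = +-∸-assoc 1 t<s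

  δ≡0⇒≡ : ∀ {x y} → x < m + a → y < m + a → δ x y ≡ 0 → x ≡ y
  δ≡0⇒≡ x<N y<N δ≡0 with vertex x<N | vertex y<N
  ... | onCycle x<m | onCycle y<m = cycleDist≡0⇒≡ m x<m y<m (≡.trans (sym (δ-cycle x<m y<m)) δ≡0)
  ... | onCycle x<m | onPath t _ refl = ⊥-elim (c+1+s≢0 _ t (≡.trans (sym (δ-cycle-path t x<m)) δ≡0))
  ... | onPath s _ refl | onCycle y<m = ⊥-elim (c+1+s≢0 _ s (≡.trans (sym (δ-path-cycle s y<m)) δ≡0))
  ... | onPath s _ refl | onPath t _ refl = cong (m +_) (∣m-n∣≡0⇒m≡n (≡.trans (sym (δ-path s t)) δ≡0))

  δ-refl : ∀ x → δ x x ≡ 0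
  δ-refl x = by-side (x <? m)
    where
    by-side : Dec (x < m) → δ x x ≡ 0
    by-side (yes x<m) = ≡.trans (δ-cycle x<m x<m) (cycleDist-self m x)
    by-side (no  x≮m) = ≡.trans (δ-path′ (≮⇒≥ x≮m) (≮⇒≥ x≮m)) (∣n-n∣≡0 x)

  δ-adj-≤ : ∀ {x y z} → x < m + a → T (adj G z y) → δ x y ≤ suc (δ x z)
  δ-adj-≤ x<N t with adj⇒Adj t
  ... | inj₁ e = proj₁ (δ-edge-≤ x<N e)
  ... | inj₂ e = proj₂ (δ-edge-≤ x<N e)

  δ-predecessor : ∀ {x y} → x < m + a → y < m + a → 0 < δ x y →
                  ∃[ z ] z < m + a × T (adj G z y) × suc (δ x z) ≡ δ x y
  δ-predecessor {x} {y} x<N y<N 0<δ with vertex x<N | vertex y<N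
  ... | onCycle x<m | onCycle y<m
    with cycleDist-predecessor m₁ (≤-pred x<m) (≤-pred y<m) (subst (0 <_) (δ-cycle x<m y<m) 0<δ)
  ... | z , z≤m₁ , z~y , cz+1≡cy =
    z , cycle<N z≤m₁ , Adj⇒adj (cycleAdj⇒Adj z~y) ,
    ≡.trans (cong suc (δ-cycle x<m (s≤s z≤m₁))) (≡.trans cz+1≡cy (sym (δ-cycle x<m y<m)))
  δ-predecessor {x} x<N y<N 0<δ | onCycle x<m | onPath zero _ refl =
    0 , cycle<N z≤n , Adj⇒adj (inj₁ (stem refl (+-identityʳ m))) ,
    ≡.trans (cong suc (≡.trans (δ-cycle x<m z<s) (cycleDist-comm m x 0)))
            (≡.trans (+-comm 1 (cyc 0 x)) (sym (δ-cycle-path 0 x<m)))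
  δ-predecessor {x} x<N y<N 0<δ | onCycle x<m | onPath (suc t) t<a refl =
    m + t , path<N (m<n⇒m<1+n (≤-pred t<a)) , Adj⇒adj (inj₁ (path t (≤-pred t<a) refl refl)) ,
    ≡.trans (cong suc (δ-cycle-path t x<m)) (≡.trans (sym (+-suc (cyc 0 x) (suc t))) (sym (δ-cycle-path (suc t) x<m)))
  δ-predecessor {_} {zero} x<N y<N 0<δ | onPath s _ refl | onCycle _ =
    m + 0 , path<N {0} z<s , Adj⇒adj (inj₂ (stem refl (+-identityʳ m))) ,
    ≡.trans (cong suc (≡.trans (δ-path s 0) (∣-∣-identityʳ s))) (sym (δ-path-cycle s z<s))
  δ-predecessor {_} {suc y} x<N y<N 0<δ | onPath s _ refl | onCycle y<m
    with cycleDist-predecessor m₁ z≤n (≤-pred y<m)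
           (n≢0⇒n>0 (λ c≡0 → 1+n≢0 (sym (cycleDist≡0⇒≡ m z<s y<m c≡0))))
  ... | z , z≤m₁ , z~y , cz+1≡cy =
    z , cycle<N z≤m₁ , Adj⇒adj (cycleAdj⇒Adj z~y) ,
    ≡.trans (cong suc (δ-path-cycle s (s≤s z≤m₁))) (≡.trans (cong (_+ suc s) cz+1≡cy) (sym (δ-path-cycle s y<m)))
  δ-predecessor x<N y<N 0<δ | onPath s _ refl | onPath t t<a refl with <-cmp s t
  ... | tri≈ _ refl _ = ⊥-elim (<-irrefl (sym (≡.trans (δ-path s s) (∣n-n∣≡0 s))) 0<δ)
  δ-predecessor x<N y<N 0<δ | onPath s _ refl | onPath (suc t) t<a refl | tri< s<t _ _ =
    m + t , path<N (m<n⇒m<1+n (≤-pred t<a)) , Adj⇒adj (inj₁ (path t (≤-pred t<a) refl refl)) ,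
    ≡.trans (cong suc (δ-path s t)) (≡.trans (sym (∣s-1+t∣≡1+∣s-t∣ (≤-pred s<t))) (sym (δ-path s (suc t))))
  δ-predecessor x<N y<N 0<δ | onPath s s<a refl | onPath t t<a refl | tri> _ _ t<s =
    m + suc t , path<N (≤-trans (s≤s t<s) s<a) , Adj⇒adj (inj₂ (path t (≤-trans t<s (≤-pred s<a)) refl refl)) ,
    ≡.trans (cong suc (δ-path s (suc t))) (≡.trans (sym (∣s-t∣≡1+∣s-1+t∣ t<s)) (sym (δ-path s t)))

  δ≤K+a : ∀ K {x y} → m ≤ suc (K + K) → x < m + a → y < m + a → δ x y ≤ K + a
  δ≤K+a K {x} {y} m≤2K+1 x<N y<N with vertex x<N | vertex y<N
  ... | onCycle x<m | onCycle y<m =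
    subst (_≤ K + a) (sym (δ-cycle x<m y<m)) (≤-trans (cycleDist≤half K x y m≤2K+1) (m≤m+n K a))
  ... | onCycle x<m | onPath t t<a refl =
    subst (_≤ K + a) (sym (δ-cycle-path t x<m)) (+-mono-≤ (cycleDist≤half K 0 _ m≤2K+1) t<a)
  ... | onPath s s<a refl | onCycle y<m =
    subst (_≤ K + a) (sym (δ-path-cycle s y<m)) (+-mono-≤ (cycleDist≤half K 0 _ m≤2K+1) s<a)
  ... | onPath s s<a refl | onPath t t<a refl =
    subst (_≤ K + a) (sym (δ-path s t)) (≤-trans (<⇒≤ (≤-<-trans (∣m-n∣≤m⊔n s t) (⊔-lub s<a t<a))) (m≤n+m a K))

  δ<N : ∀ {x y} → x < m + a → y < m + a → δ x y < m + a
  δ<N x<N y<N = s≤s (δ≤K+a m₁ (s≤s (m≤m+n m₁ m₁)) x<N y<N)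

  isGraphDistance : IsGraphDistance G δ
  isGraphDistance = record
    { δ≡0⇒≡ = δ≡0⇒≡ ; δ-refl = δ-refl ; δ-adj-≤ = δ-adj-≤ ; δ-predecessor = δ-predecessor ; δ<N = δ<N }

  open GraphDistance isGraphDistance public

  deg-≡ : ∀ x ps → Unique ps → All (_< m + a) ps → All (Adj x) ps → (∀ {y} → Adj x y → y ∈ ps) →
          deg G x ≡ length ps
  deg-≡ x ps ps! ps<N adj-ps nbrs = ≡.trans (length-filter-applyUpTo (m + a) (adj G x) id)
    (∑-𝟙-exactly (m + a) (adj G x) ps ps! ps<N (All.map Adj⇒adj adj-ps) (λ y t → nbrs (adj⇒Adj t)))

  private
    m₁<m : m₁ < m
    m₁<m = n<1+n m₁

    0<m₁ : 0 < m₁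
    0<m₁ = ≤-trans (s≤s z≤n) 2≤m₁

    cycle≢path : ∀ {j} s → j < m → j ≢ m + s
    cycle≢path s j<m j≡m+s = <⇒≱ j<m (subst (m ≤_) (sym j≡m+s) (m≤m+n m s))

  neighbours-0 : ∀ {y} → Adj 0 y → y ∈ 1 ∷ m₁ ∷ m ∷ []
  neighbours-0 (inj₁ (wrap 0≡m₁ _))          = ⊥-elim (<⇒≢ 0<m₁ 0≡m₁)
  neighbours-0 (inj₁ (cycle _ _ refl y≡1))  = here y≡1
  neighbours-0 (inj₁ (stem _ y≡m))          = there (there (here y≡m))
  neighbours-0 (inj₁ (path _ _ () _))
  neighbours-0 (inj₂ (wrap y≡m₁ _))         = there (here y≡m₁)
  neighbours-0 (inj₂ (cycle _ _ _ ()))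
  neighbours-0 (inj₂ (stem _ ()))
  neighbours-0 (inj₂ (path _ _ _ ()))

  neighbours-cycle : ∀ {i y} → suc i < m₁ → Adj (suc i) y → y ∈ i ∷ suc (suc i) ∷ []
  neighbours-cycle i+1<m₁ (inj₁ (wrap i+1≡m₁ _))      = ⊥-elim (<⇒≢ i+1<m₁ i+1≡m₁)
  neighbours-cycle _      (inj₁ (cycle _ _ refl y≡))  = there (here y≡)
  neighbours-cycle _      (inj₁ (stem () _))
  neighbours-cycle i+1<m₁ (inj₁ (path j _ e _))       = ⊥-elim (cycle≢path j (m<n⇒m<1+n i+1<m₁) e)
  neighbours-cycle _      (inj₂ (wrap _ ()))
  neighbours-cycle _      (inj₂ (cycle _ _ y≡ refl)) = here y≡
  neighbours-cycle i+1<m₁ (inj₂ (stem _ i+1≡m))       = ⊥-elim (<⇒≢ (m<n⇒m<1+n i+1<m₁) i+1≡m)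
  neighbours-cycle i+1<m₁ (inj₂ (path j _ _ e))       = ⊥-elim (cycle≢path (suc j) (m<n⇒m<1+n i+1<m₁) e)

  neighbours-last : ∀ {i y} → suc i ≡ m₁ → Adj (suc i) y → y ∈ i ∷ 0 ∷ []
  neighbours-last _      (inj₁ (wrap _ y≡0))          = there (here y≡0)
  neighbours-last i+1≡m₁ (inj₁ (cycle j j<m₁ e _))    = ⊥-elim (<⇒≢ j<m₁ (≡.trans (sym e) i+1≡m₁))
  neighbours-last _      (inj₁ (stem () _))
  neighbours-last i+1≡m₁ (inj₁ (path j _ e _))        = ⊥-elim (cycle≢path j (subst (_< m) (sym i+1≡m₁) m₁<m) e)
  neighbours-last _      (inj₂ (wrap _ ()))
  neighbours-last _      (inj₂ (cycle _ _ y≡ refl))   = here y≡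
  neighbours-last i+1≡m₁ (inj₂ (stem _ e))            = ⊥-elim (<⇒≢ (subst (_< m) (sym i+1≡m₁) m₁<m) e)
  neighbours-last i+1≡m₁ (inj₂ (path j _ _ e))        = ⊥-elim (cycle≢path (suc j) (subst (_< m) (sym i+1≡m₁) m₁<m) e)

  pathPrev : ℕ → ℕ
  pathPrev zero    = 0
  pathPrev (suc s) = m + s

  pathPrev-edge : ∀ {s} → s ≤ a₁ → Edge (pathPrev s) (m + s)
  pathPrev-edge {zero}  _          = stem refl (+-identityʳ m)
  pathPrev-edge {suc s} s<a₁ = path s s<a₁ refl refl

  pathPrev<N : ∀ s → s ≤ a₁ → pathPrev s < m + a
  pathPrev<N zero    _          = cycle<N z≤n
  pathPrev<N (suc s) s<a₁ = path<N (m<n⇒m<1+n s<a₁)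

  neighbours-path : ∀ {s y} → Adj (m + s) y → y ≡ pathPrev s ⊎ (s < a₁ × y ≡ m + suc s)
  neighbours-path {s} (inj₁ (wrap e _))              = ⊥-elim (cycle≢path s m₁<m (sym e))
  neighbours-path {s} (inj₁ (cycle j j<m₁ e _))      = ⊥-elim (cycle≢path s (m<n⇒m<1+n j<m₁) (sym e))
  neighbours-path     (inj₁ (stem () _))
  neighbours-path {s} (inj₁ (path j j<a₁ e y≡))
    with refl ← +-cancelˡ-≡ m s j e               = inj₂ (j<a₁ , y≡)
  neighbours-path     (inj₂ (wrap _ ()))
  neighbours-path {s} (inj₂ (cycle j j<m₁ _ e))      = ⊥-elim (cycle≢path s (s≤s j<m₁) (sym e))
  neighbours-path {s} (inj₂ (stem y≡0 e))
    with refl ← +-cancelˡ-≡ m s 0 (≡.trans e (sym (+-identityʳ m))) = inj₁ y≡0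
  neighbours-path {s} (inj₂ (path j _ y≡ e))
    with refl ← +-cancelˡ-≡ m s (suc j) e         = inj₁ y≡

  deg-0 : deg G 0 ≡ 3
  deg-0 = deg-≡ 0 (1 ∷ m₁ ∷ m ∷ [])
    ((<⇒≢ 2≤m₁ ∷ <⇒≢ (s≤s 0<m₁) ∷ []) ∷ (<⇒≢ m₁<m ∷ []) ∷ [] ∷ [])
    (cycle<N 0<m₁ ∷ cycle<N ≤-refl ∷ m<m+n m z<s ∷ [])
    (inj₁ (cycle 0 0<m₁ refl refl) ∷ inj₂ (wrap refl refl) ∷ inj₁ (stem refl refl) ∷ [])
    neighbours-0

  deg-cycle : ∀ {i} → i < m₁ → deg G (suc i) ≡ 2
  deg-cycle {i} i<m₁ with suc i <? m₁
  ... | yes i+1<m₁ = deg-≡ (suc i) (i ∷ suc (suc i) ∷ [])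
    ((<⇒≢ (m<n⇒m<1+n (n<1+n i)) ∷ []) ∷ [] ∷ [])
    (cycle<N (<⇒≤ i<m₁) ∷ cycle<N i+1<m₁ ∷ [])
    (inj₂ (cycle i i<m₁ refl refl) ∷ inj₁ (cycle (suc i) i+1<m₁ refl refl) ∷ [])
    (neighbours-cycle i+1<m₁)
  ... | no  i+1≮m₁ = deg-≡ (suc i) (i ∷ 0 ∷ [])
    (((λ i≡0 → <⇒≢ (subst (2 ≤_) (sym i+1≡m₁) 2≤m₁) (cong suc (sym i≡0))) ∷ []) ∷ [] ∷ [])
    (cycle<N (<⇒≤ i<m₁) ∷ cycle<N z≤n ∷ [])
    (inj₂ (cycle i i<m₁ refl refl) ∷ inj₁ (wrap i+1≡m₁ refl) ∷ [])
    (neighbours-last i+1≡m₁)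
    where
    i+1≡m₁ : suc i ≡ m₁
    i+1≡m₁ = ≤-antisym i<m₁ (≮⇒≥ i+1≮m₁)

  deg-path : ∀ {s} → s < a₁ → deg G (m + s) ≡ 2
  deg-path {s} s<a₁ = deg-≡ (m + s) (pathPrev s ∷ m + suc s ∷ [])
    ((prev≢next s ∷ []) ∷ [] ∷ [])
    (pathPrev<N s (<⇒≤ s<a₁) ∷ path<N (s≤s s<a₁) ∷ [])
    (inj₂ (pathPrev-edge (<⇒≤ s<a₁)) ∷ inj₁ (path s s<a₁ refl refl) ∷ [])
    nbrs
    where
    nbrs : ∀ {y} → Adj (m + s) y → y ∈ pathPrev s ∷ m + suc s ∷ []
    nbrs y~ with neighbours-path y~
    ... | inj₁ y≡prev       = here y≡prev
    ... | inj₂ (_ , y≡next) = there (here y≡next)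
    prev≢next : ∀ s → pathPrev s ≢ m + suc s
    prev≢next zero    ()
    prev≢next (suc j) e = <⇒≢ (m<n⇒m<1+n (n<1+n j)) (+-cancelˡ-≡ m j (suc (suc j)) e)

  deg-end : deg G (m + a₁) ≡ 1
  deg-end = deg-≡ (m + a₁) (pathPrev a₁ ∷ [])
    ([] ∷ [])
    (pathPrev<N a₁ ≤-refl ∷ [])
    (inj₂ (pathPrev-edge ≤-refl) ∷ [])
    nbrs
    where
    nbrs : ∀ {y} → Adj (m + a₁) y → y ∈ pathPrev a₁ ∷ []
    nbrs y~ with neighbours-path y~
    ... | inj₁ y≡prev       = here y≡prev
    ... | inj₂ (a₁<a₁ , _)  = ⊥-elim (<-irrefl refl a₁<a₁)

  ∑-vertices : ∀ h → ∑ (m + a) h ≡ (h 0 + ∑[ i < m₁ ] h (suc i)) + (∑[ s < a₁ ] h (m + s) + h (m + a₁))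
  ∑-vertices h = ≡.trans (∑-+ m a h) (cong ((h 0 + ∑ m₁ (h ∘ suc)) +_) (∑-suc a₁ (λ s → h (m + s))))

  ∑-deg-* : ∀ t → ∑[ x < m + a ] (deg G x * t x) + t (m + a₁) ≡ 2 * ∑ (m + a) t + t 0
  ∑-deg-* t = begin
    ∑ (m + a) h + t end
      ≡⟨ cong (_+ t end) (∑-vertices h) ⟩
    (h 0 + ∑[ i < m₁ ] h (suc i)) + (∑[ s < a₁ ] h (m + s) + h end) + t end
      ≡⟨ cong (λ u → u + t end) (cong₂ _+_ (cong₂ _+_ (cong (_* t 0) deg-0) cycle-part)
                                            (cong₂ _+_ path-part (cong (_* t end) deg-end))) ⟩
    (3 * t 0 + 2 * ∑[ i < m₁ ] t (suc i)) + (2 * ∑[ s < a₁ ] t (m + s) + 1 * t end) + t end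
      ≡⟨ e (t 0) (∑[ i < m₁ ] t (suc i)) (∑[ s < a₁ ] t (m + s)) (t end) ⟩
    2 * ((t 0 + ∑[ i < m₁ ] t (suc i)) + (∑[ s < a₁ ] t (m + s) + t end)) + t 0
      ≡⟨ cong (λ w → 2 * w + t 0) (sym (∑-vertices t)) ⟩
    2 * ∑ (m + a) t + t 0
      ∎
    where
    open ≡-Reasoning
    end = m + a₁
    h : ℕ → ℕ
    h x = deg G x * t x
    cycle-part : ∑[ i < m₁ ] h (suc i) ≡ 2 * ∑[ i < m₁ ] t (suc i)
    cycle-part = ≡.trans (∑-cong m₁ (λ i i<m₁ → cong (_* t (suc i)) (deg-cycle i<m₁))) (∑-*ˡ m₁ 2 (t ∘ suc))
    path-part : ∑[ s < a₁ ] h (m + s) ≡ 2 * ∑[ s < a₁ ] t (m + s)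
    path-part = ≡.trans (∑-cong a₁ (λ s s<a₁ → cong (_* t (m + s)) (deg-path s<a₁))) (∑-*ˡ a₁ 2 (λ s → t (m + s)))
    e : ∀ u c p v → (3 * u + 2 * c) + (2 * p + 1 * v) + v ≡ 2 * ((u + c) + (p + v)) + u
    e = solve-∀

  edges≡ : edges G ≡ m + a
  edges≡ = begin
    sum (map (deg G) (upTo (m + a))) / 2     ≡⟨ cong (_/ 2) (sum-map-applyUpTo (m + a) (deg G) id) ⟩
    ∑ (m + a) (deg G) / 2                    ≡⟨ cong (_/ 2) ∑deg≡2N ⟩
    (m + a) * 2 / 2                          ≡⟨ m*n/n≡m (m + a) 2 ⟩
    m + a                                    ∎
    where
    open ≡-Reasoning
    ∑deg≡2N : ∑ (m + a) (deg G) ≡ (m + a) * 2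
    ∑deg≡2N = begin
      ∑ (m + a) (deg G)                   ≡⟨ ∑-cong (m + a) (λ x _ → sym (*-identityʳ (deg G x))) ⟩
      ∑[ x < m + a ] (deg G x * 1)        ≡⟨ +-cancelʳ-≡ 1 _ _ (∑-deg-* (λ _ → 1)) ⟩
      2 * ∑[ _ < m + a ] 1                ≡⟨ cong (2 *_) (≡.trans (∑-const (m + a) 1) (*-identityʳ (m + a))) ⟩
      2 * (m + a)                         ≡⟨ *-comm 2 (m + a) ⟩
      (m + a) * 2                         ∎

  Sᶜ Sᵖ Wᵖ : ℕ
  Sᶜ = cycleTrans m
  Sᵖ = ∑ a suc
  Wᵖ = ∑∑∣s-t∣ a

  ∑δ-cycle : ∀ {i} → i < m → ∑ (m + a) (δ i) ≡ Sᶜ + (a * cyc 0 i + Sᵖ)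
  ∑δ-cycle {i} i<m = begin
    ∑ (m + a) (δ i)                                        ≡⟨ ∑-+ m a (δ i) ⟩
    ∑ m (δ i) + ∑[ t < a ] δ i (m + t)                     ≡⟨ cong₂ _+_
        (≡.trans (∑-cong m (λ y y<m → δ-cycle i<m y<m)) (∑-cycleDist-rotate i<m))
        (∑-cong a (λ t _ → δ-cycle-path t i<m)) ⟩
    Sᶜ + ∑[ t < a ] (cyc 0 i + suc t)                       ≡⟨ cong (Sᶜ +_) (∑-distrib-+ a (λ _ → cyc 0 i) suc) ⟩
    Sᶜ + (∑[ _ < a ] cyc 0 i + Sᵖ)                           ≡⟨ cong (λ w → Sᶜ + (w + Sᵖ)) (∑-const a (cyc 0 i)) ⟩
    Sᶜ + (a * cyc 0 i + Sᵖ)                                  ∎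
    where open ≡-Reasoning

  ∑δ-path : ∀ s → ∑ (m + a) (δ (m + s)) ≡ (Sᶜ + m * suc s) + ∑[ t < a ] ∣ s - t ∣
  ∑δ-path s = begin
    ∑ (m + a) (δ (m + s))                                  ≡⟨ ∑-+ m a (δ (m + s)) ⟩
    ∑ m (δ (m + s)) + ∑[ t < a ] δ (m + s) (m + t)         ≡⟨ cong₂ _+_
        (∑-cong m (λ y y<m → δ-path-cycle s y<m)) (∑-cong a (λ t _ → δ-path s t)) ⟩
    ∑[ y < m ] (cyc 0 y + suc s) + ∑[ t < a ] ∣ s - t ∣     ≡⟨ cong (_+ ∑[ t < a ] ∣ s - t ∣)
        (≡.trans (∑-distrib-+ m (cyc 0) (λ _ → suc s)) (cong (Sᶜ +_) (∑-const m (suc s)))) ⟩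
    (Sᶜ + m * suc s) + ∑[ t < a ] ∣ s - t ∣                 ∎
    where open ≡-Reasoning

  ∑∑δ : ∑[ x < m + a ] ∑ (m + a) (δ x) ≡ (m * Sᶜ + (a * Sᶜ + m * Sᵖ)) + ((a * Sᶜ + m * Sᵖ) + Wᵖ)
  ∑∑δ = begin
    ∑[ x < m + a ] ∑ (m + a) (δ x)
      ≡⟨ ∑-+ m a (λ x → ∑ (m + a) (δ x)) ⟩
    ∑[ i < m ] ∑ (m + a) (δ i) + ∑[ s < a ] ∑ (m + a) (δ (m + s))
      ≡⟨ cong₂ _+_ (∑-cong m (λ i → ∑δ-cycle)) (∑-cong a (λ s _ → ∑δ-path s)) ⟩
    ∑[ i < m ] (Sᶜ + (a * cyc 0 i + Sᵖ)) + ∑[ s < a ] ((Sᶜ + m * suc s) + ∑[ t < a ] ∣ s - t ∣)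
      ≡⟨ cong₂ _+_ cycle-rows path-rows ⟩
    (m * Sᶜ + (a * Sᶜ + m * Sᵖ)) + ((a * Sᶜ + m * Sᵖ) + Wᵖ)
      ∎
    where
    open ≡-Reasoning
    cycle-rows : ∑[ i < m ] (Sᶜ + (a * cyc 0 i + Sᵖ)) ≡ m * Sᶜ + (a * Sᶜ + m * Sᵖ)
    cycle-rows = begin
      ∑[ i < m ] (Sᶜ + (a * cyc 0 i + Sᵖ))        ≡⟨ ∑-distrib-+ m (λ _ → Sᶜ) (λ i → a * cyc 0 i + Sᵖ) ⟩
      ∑[ _ < m ] Sᶜ + ∑[ i < m ] (a * cyc 0 i + Sᵖ) ≡⟨ cong₂ _+_ (∑-const m Sᶜ) (∑-distrib-+ m (λ i → a * cyc 0 i) (λ _ → Sᵖ)) ⟩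
      m * Sᶜ + (∑[ i < m ] (a * cyc 0 i) + ∑[ _ < m ] Sᵖ) ≡⟨ cong (m * Sᶜ +_) (cong₂ _+_ (∑-*ˡ m a (cyc 0)) (∑-const m Sᵖ)) ⟩
      m * Sᶜ + (a * Sᶜ + m * Sᵖ)                   ∎
    path-rows : ∑[ s < a ] ((Sᶜ + m * suc s) + ∑[ t < a ] ∣ s - t ∣) ≡ (a * Sᶜ + m * Sᵖ) + Wᵖ
    path-rows = begin
      ∑[ s < a ] ((Sᶜ + m * suc s) + ∑[ t < a ] ∣ s - t ∣)   ≡⟨ ∑-distrib-+ a (λ s → Sᶜ + m * suc s) (λ s → ∑[ t < a ] ∣ s - t ∣) ⟩
      ∑[ s < a ] (Sᶜ + m * suc s) + Wᵖ                       ≡⟨ cong (_+ Wᵖ) (∑-distrib-+ a (λ _ → Sᶜ) (λ s → m * suc s)) ⟩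
      ∑[ _ < a ] Sᶜ + ∑[ s < a ] (m * suc s) + Wᵖ           ≡⟨ cong (_+ Wᵖ) (cong₂ _+_ (∑-const a Sᶜ) (∑-*ˡ a m suc)) ⟩
      (a * Sᶜ + m * Sᵖ) + Wᵖ                                  ∎

  degDist+trans-end : degDist G + ((Sᶜ + m * a) + ∑[ t < a ] ∣ a₁ - t ∣)
                      ≡ 2 * ((m * Sᶜ + (a * Sᶜ + m * Sᵖ)) + ((a * Sᶜ + m * Sᵖ) + Wᵖ)) + (Sᶜ + (a * 0 + Sᵖ))
  degDist+trans-end = begin
    degDist G + ((Sᶜ + m * a) + ∑[ t < a ] ∣ a₁ - t ∣)
      ≡⟨ cong₂ _+_ degDist≡ (sym (∑δ-path a₁)) ⟩
    ∑[ x < m + a ] (deg G x * ∑ (m + a) (δ x)) + ∑ (m + a) (δ (m + a₁))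
      ≡⟨ ∑-deg-* (λ x → ∑ (m + a) (δ x)) ⟩
    2 * ∑[ x < m + a ] ∑ (m + a) (δ x) + ∑ (m + a) (δ 0)
      ≡⟨ cong₂ (λ u v → 2 * u + v) ∑∑δ (∑δ-cycle z<s) ⟩
    2 * ((m * Sᶜ + (a * Sᶜ + m * Sᵖ)) + ((a * Sᶜ + m * Sᵖ) + Wᵖ)) + (Sᶜ + (a * 0 + Sᵖ))
      ∎
    where
    open ≡-Reasoning
    degDist≡ : degDist G ≡ ∑[ x < m + a ] (deg G x * ∑ (m + a) (δ x))
    degDist≡ = ≡.trans (sum-map-applyUpTo (m + a) (λ x → deg G x * trans G x) id)
                       (∑-cong (m + a) (λ x x<N → cong (deg G x *_) (trans≡∑δ x<N)))

  3*degDist≡ : 3 * degDist G ≡ 6 * m * Sᶜ + 12 * a * Sᶜ + 6 * m * a * a + 3 * m * a + 2 * a * a * a + a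
  3*degDist≡ = *-cancelˡ-≡ _ _ 2 (+-cancelʳ-≡ X _ _ (begin
    2 * (3 * D) + X
      ≡⟨ e₁ D Sᶜ m a R ⟩
    6 * (D + ((Sᶜ + m * a) + R)) + 4 * a
      ≡⟨ cong (λ w → 6 * w + 4 * a) degDist+trans-end ⟩
    6 * (2 * ((m * Sᶜ + (a * Sᶜ + m * Sᵖ)) + ((a * Sᶜ + m * Sᵖ) + Wᵖ)) + (Sᶜ + (a * 0 + Sᵖ))) + 4 * a
      ≡⟨ e₂ Sᶜ m a Sᵖ Wᵖ ⟩
    12 * (m * Sᶜ) + 24 * (a * Sᶜ) + 12 * (m * (2 * Sᵖ)) + 4 * (3 * Wᵖ + a) + 6 * Sᶜ + 3 * (2 * Sᵖ)
      ≡⟨ cong₂ (λ u v → 12 * (m * Sᶜ) + 24 * (a * Sᶜ) + 12 * (m * u) + 4 * v + 6 * Sᶜ + 3 * u)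
               (2*∑suc≡n*[1+n] a) (3*∑∑∣s-t∣+n≡n³ a) ⟩
    12 * (m * Sᶜ) + 24 * (a * Sᶜ) + 12 * (m * (a * suc a)) + 4 * (a * a * a) + 6 * Sᶜ + 3 * (a * suc a)
      ≡⟨ e₃ Sᶜ m a₁ ⟩
    2 * F + (6 * Sᶜ + 6 * (m * a) + 3 * (a₁ * a) + 4 * a)
      ≡⟨ cong (λ w → 2 * F + (6 * Sᶜ + 6 * (m * a) + 3 * w + 4 * a)) (sym (2*∑∣n-t∣≡n*[1+n] a₁)) ⟩
    2 * F + X
      ∎))
    where
    open ≡-Reasoning
    D = degDist G
    R = ∑[ t < a ] ∣ a₁ - t ∣
    F = 6 * m * Sᶜ + 12 * a * Sᶜ + 6 * m * a * a + 3 * m * a + 2 * a * a * a + a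
    X = 6 * Sᶜ + 6 * (m * a) + 3 * (2 * R) + 4 * a
    e₁ : ∀ D S m a R → 2 * (3 * D) + (6 * S + 6 * (m * a) + 3 * (2 * R) + 4 * a) ≡ 6 * (D + ((S + m * a) + R)) + 4 * a
    e₁ = solve-∀
    e₂ : ∀ S m a T W → 6 * (2 * ((m * S + (a * S + m * T)) + ((a * S + m * T) + W)) + (S + (a * 0 + T))) + 4 * a
                      ≡ 12 * (m * S) + 24 * (a * S) + 12 * (m * (2 * T)) + 4 * (3 * W + a) + 6 * S + 3 * (2 * T)
    e₂ = solve-∀
    e₃ : ∀ S m a₁ → let a = suc a₁ in
         12 * (m * S) + 24 * (a * S) + 12 * (m * (a * suc a)) + 4 * (a * a * a) + 6 * S + 3 * (a * suc a)
         ≡ 2 * (6 * m * S + 12 * a * S + 6 * m * a * a + 3 * m * a + 2 * a * a * a + a)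
           + (6 * S + 6 * (m * a) + 3 * (a₁ * a) + 4 * a)
    e₃ = solve-∀

  diam≡ : diam G ≡ m / 2 + a
  diam≡ = ≤-antisym (diam≤ (K + a) (δ≤K+a K m≤1+2K)) (begin
    K + a                  ≡⟨ cong (_+ a) (sym (cycleDist-0-≤half K 2K≤m)) ⟩
    cyc 0 K + suc a₁       ≡⟨ sym (δ-path-cycle a₁ K<m) ⟩
    δ (m + a₁) K           ≤⟨ δ≤diam (path<N ≤-refl) (cycle<N (≤-pred K<m)) ⟩
    diam G                 ∎)
    where
    open ≤-Reasoning
    K = m / 2
    K<m : K < m
    K<m = m/n<m m 2 (s≤s (s≤s z≤n))
    K*2≡K+K : ∀ K → K * 2 ≡ K + K
    K*2≡K+K = solve-∀
    2K≤m : K + K ≤ m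
    2K≤m = subst (_≤ m) (K*2≡K+K K) (m/n*n≤m m 2)
    m≤1+2K : m ≤ suc (K + K)
    m≤1+2K = begin
      m                  ≡⟨ m≡m%n+[m/n]*n m 2 ⟩
      m % 2 + K * 2      ≤⟨ +-monoˡ-≤ (K * 2) (≤-pred (m%n<n m 2)) ⟩
      1 + K * 2          ≡⟨ cong suc (K*2≡K+K K) ⟩
      suc (K + K)        ∎

-- Moving two vertices from the cycle to the path

+a-+b<+c-+d : ∀ {a b c d} → a + d < c + b → ℤ.+ a ℤ.- ℤ.+ b <ℤ ℤ.+ c ℤ.- ℤ.+ d
+a-+b<+c-+d {a} {b} {c} {d} a+d<c+b = subst₂ _<ℤ_
  (sym (≡.trans (ℤ.m-n≡m⊖n a b) (sym (ℤ.+-cancelˡ-⊖ d a b))))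
  (sym (≡.trans (ℤ.m-n≡m⊖n c d) (≡.trans (sym (ℤ.+-cancelˡ-⊖ b c d)) (cong ((b + c) ℤ.⊖_) (+-comm b d)))))
  (ℤ.⊖-monoˡ-< (d + b) (subst₂ _<_ (+-comm a d) (+-comm c b) a+d<c+b))

<-from-slack : ∀ {u v s t r} → u + s ≡ v + t + suc r → s ≤ t → v < u
<-from-slack {u} {v} {s} {t} {r} eq s≤t = +-cancelʳ-< t v u (begin-strict
  v + t             <⟨ m<m+n (v + t) z<s ⟩
  v + t + suc r     ≡⟨ sym eq ⟩
  u + s             ≤⟨ +-monoʳ-≤ u s≤t ⟩
  u + t             ∎)
  where open ≤-Reasoning

module CycleToPath (p₁ a₁ : ℕ) (2≤p₁ : 2 ≤ p₁) where

  module T₁ = Tadpole (2 + p₁) a₁ (≤-trans 2≤p₁ (≤-trans (n≤1+n p₁) (n≤1+n _)))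
  module T₂ = Tadpole p₁ (a₁ + 2) 2≤p₁

  p a n c : ℕ
  p = suc p₁
  a = suc a₁
  n = 2 + p + a
  c = 2 * (n ∸ 1) * n

  p+[a+2]≡n : p + (a + 2) ≡ n
  p+[a+2]≡n = e p₁ a₁
    where
    e : ∀ p₁ a₁ → suc p₁ + (suc a₁ + 2) ≡ 2 + suc p₁ + suc a₁
    e = solve-∀

  -- The cycle sum grows by p + 1 from C_p to C_{p+2}, and is at most p² on C_p.
  degDist-< : degDist T₂.G < degDist T₁.G + c
  degDist-< = *-cancelˡ-< 3 _ _ (subst₂ _<_ (sym T₂.3*degDist≡) 3D₁+3c≡ F₂<F₁+3c)
    where
    S = cycleTrans p
    F₁ = 6 * (2 + p) * T₁.Sᶜ + 12 * a * T₁.Sᶜ + 6 * (2 + p) * a * a + 3 * (2 + p) * a + 2 * a * a * a + a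
    F₂ = 6 * p * S + 12 * (a + 2) * S + 6 * p * (a + 2) * (a + 2) + 3 * p * (a + 2)
         + 2 * (a + 2) * (a + 2) * (a + 2) + (a + 2)
    polynomial : ∀ p₁ a₁ S → let p = suc p₁ ; a = suc a₁ ; Sᶜ = S + suc p in
      (6 * (2 + p) * Sᶜ + 12 * a * Sᶜ + 6 * (2 + p) * a * a + 3 * (2 + p) * a + 2 * a * a * a + a)
        + 3 * (2 * suc (p + a) * (2 + p + a)) + 12 * S
      ≡ (6 * p * S + 12 * (a + 2) * S + 6 * p * (a + 2) * (a + 2) + 3 * p * (a + 2)
         + 2 * (a + 2) * (a + 2) * (a + 2) + (a + 2))
        + 12 * (p * p) + suc (6 * (a * a) + 6 * p + 12 * a + 5)
    polynomial = solve-∀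
    F₂<F₁+3c : F₂ < F₁ + 3 * c
    F₂<F₁+3c = <-from-slack slack (*-monoʳ-≤ 12 (cycleTrans≤square p))
      where
      F₁′ : ℕ → ℕ
      F₁′ Sᶜ = 6 * (2 + p) * Sᶜ + 12 * a * Sᶜ + 6 * (2 + p) * a * a + 3 * (2 + p) * a + 2 * a * a * a + a
      slack : F₁ + 3 * c + 12 * S ≡ F₂ + 12 * (p * p) + suc (6 * (a * a) + 6 * p + 12 * a + 5)
      slack = ≡.trans (cong (λ Sᶜ → F₁′ Sᶜ + 3 * c + 12 * S) (cycleTrans-+2 p)) (polynomial p₁ a₁ S)
    3D₁+3c≡ : F₁ + 3 * c ≡ 3 * (degDist T₁.G + c)
    3D₁+3c≡ = ≡.trans (cong (_+ 3 * c) (sym T₁.3*degDist≡)) (sym (*-distribˡ-+ 3 (degDist T₁.G) c))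

  diam₂≡1+diam₁ : diam T₂.G ≡ suc (diam T₁.G)
  diam₂≡1+diam₁ = begin
    diam T₂.G                ≡⟨ T₂.diam≡ ⟩
    p / 2 + (a + 2)          ≡⟨ e (p / 2) a ⟩
    suc (suc (p / 2) + a)    ≡⟨ cong (λ k → suc (k + a)) (sym (m/n≡1+[m∸n]/n {2 + p} {2} (s≤s (s≤s z≤n)))) ⟩
    suc ((2 + p) / 2 + a)    ≡⟨ cong suc (sym T₁.diam≡) ⟩
    suc (diam T₁.G)          ∎
    where
    open ≡-Reasoning
    e : ∀ k a → k + (a + 2) ≡ suc (suc k + a)
    e = solve-∀

  revDegDist₁≡ : revDegDist T₁.G ≡ ℤ.+ (c * diam T₁.G) ℤ.- ℤ.+ degDist T₁.G
  revDegDist₁≡ = cong (λ e → ℤ.+ (2 * (n ∸ 1) * e * diam T₁.G) ℤ.- ℤ.+ degDist T₁.G) T₁.edges≡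

  revDegDist₂≡ : revDegDist T₂.G ≡ ℤ.+ (c * suc (diam T₁.G)) ℤ.- ℤ.+ degDist T₂.G
  revDegDist₂≡ = cong (λ w → ℤ.+ w ℤ.- ℤ.+ degDist T₂.G) (begin
    2 * (N T₂.G ∸ 1) * edges T₂.G * diam T₂.G       ≡⟨ cong₂ (λ e d → 2 * (N T₂.G ∸ 1) * e * d) T₂.edges≡ diam₂≡1+diam₁ ⟩
    2 * (N T₂.G ∸ 1) * N T₂.G * suc (diam T₁.G)     ≡⟨ cong (λ k → 2 * (k ∸ 1) * k * suc (diam T₁.G)) p+[a+2]≡n ⟩
    c * suc (diam T₁.G)                             ∎)
    where open ≡-Reasoning

  revDegDist-< : revDegDist T₁.G <ℤ revDegDist T₂.G
  revDegDist-< = subst₂ _<ℤ_ (sym revDegDist₁≡) (sym revDegDist₂≡)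
    (+a-+b<+c-+d {c * d} {degDist T₁.G} {c * suc d} {degDist T₂.G} (begin-strict
    c * d + degDist T₂.G             <⟨ +-monoʳ-< (c * d) degDist-< ⟩
    c * d + (degDist T₁.G + c)       ≡⟨ e (c * d) (degDist T₁.G) c ⟩
    (c + c * d) + degDist T₁.G       ≡⟨ cong (_+ degDist T₁.G) (sym (*-suc c d)) ⟩
    c * suc d + degDist T₁.G         ∎))
    where
    open ≤-Reasoning
    d = diam T₁.G
    e : ∀ x y z → x + (y + z) ≡ (z + x) + y
    e = solve-∀

U-no-pendants : ∀ n m d a → n ∸ d ∸ (m + 1) / 2 ≡ 0 → U n m d a 0 ≡ tadpole m a
U-no-pendants n m d a h≡0 = cong₂ graph
  (≡.trans (cong (m + a + 0 +_) h≡0) (≡.trans (+-identityʳ _) (+-identityʳ _)))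
  (≡.trans (cong (λ h → cycleEdges m ++ pathEdges 0 m a ++ map (λ i → 0 , m + a + 0 + i) (upTo h)) h≡0)
           (cong (cycleEdges m ++_) (++-identityʳ (pathEdges 0 m a))))
  where
  graph : ℕ → List (ℕ × ℕ) → Graph
  graph N es = record { N = N ; adj = adjOf es }

U₁≡tadpole : ∀ n m a → (m + 1) / 2 ≤ n → U n m (n ∸ (m + 1) / 2) a 0 ≡ tadpole m a
U₁≡tadpole n m a c≤n =
  U-no-pendants n m (n ∸ (m + 1) / 2) a (≡.trans (cong (_∸ (m + 1) / 2) (m∸[m∸n]≡n c≤n)) (n∸n≡0 ((m + 1) / 2)))

U₂≡tadpole : ∀ n m a → 2 ≤ m → (m + 1) / 2 ≤ n → U n (m ∸ 2) (n ∸ (m + 1) / 2 + 1) a 0 ≡ tadpole (m ∸ 2) a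
U₂≡tadpole n (suc (suc p)) a (s≤s (s≤s _)) c≤n = U-no-pendants n p (n ∸ c + 1) a (begin
  n ∸ (n ∸ c + 1) ∸ (p + 1) / 2     ≡⟨ cong (_∸ (p + 1) / 2) (sym (∸-+-assoc n (n ∸ c) 1)) ⟩
  n ∸ (n ∸ c) ∸ 1 ∸ (p + 1) / 2     ≡⟨ cong (λ k → k ∸ 1 ∸ (p + 1) / 2) (m∸[m∸n]≡n c≤n) ⟩
  c ∸ 1 ∸ (p + 1) / 2               ≡⟨ cong (λ k → k ∸ 1 ∸ (p + 1) / 2) (m/n≡1+[m∸n]/n {2 + p + 1} {2} (s≤s (s≤s z≤n))) ⟩
  (p + 1) / 2 ∸ (p + 1) / 2         ≡⟨ n∸n≡0 ((p + 1) / 2) ⟩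
  0                                 ∎)
  where
  open ≡-Reasoning
  c = (2 + p + 1) / 2

m≤n∸1⇒m<n : ∀ {m n} → 0 < m → m ≤ n ∸ 1 → m < n
m≤n∸1⇒m<n {n = suc n} 0<m m≤n = s≤s m≤n
m≤n∸1⇒m<n {n = zero}  0<m m≤0 = ⊥-elim (<⇒≱ 0<m m≤0)

[m+1]/2≤m : ∀ m → (m + 1) / 2 ≤ m
[m+1]/2≤m m = subst (λ k → k / 2 ≤ m) (+-comm 1 m) (≤-pred (m/n<m (suc m) 2 (s≤s (s≤s z≤n))))

m<n⇒n∸m≡1+n∸[1+m] : ∀ {m n} → m < n → n ∸ m ≡ suc (n ∸ suc m)
m<n⇒n∸m≡1+n∸[1+m] {m} {suc n} (s≤s m≤n) = +-∸-assoc 1 m≤n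

lemma10 : (n m : ℕ) → 5 ≤ m → m ≤ n ∸ 1 →
          revDegDist (U n m (n ∸ (m + 1) / 2) (n ∸ m) 0)
            <ℤ revDegDist (U n (m ∸ 2) (n ∸ (m + 1) / 2 + 1) (n ∸ m + 2) 0)
lemma10 n m 5≤m m≤n-1 =
  subst₂ (λ G₁ G₂ → revDegDist G₁ <ℤ revDegDist G₂) (sym U₁≡T₁) (sym U₂≡T₂) revDegDist-<
  where
  p₁ = m ∸ 3
  a₁ = n ∸ suc m
  m<n : m < n
  m<n = m≤n∸1⇒m<n (≤-trans (s≤s z≤n) 5≤m) m≤n-1
  c≤n : (m + 1) / 2 ≤ n
  c≤n = ≤-trans ([m+1]/2≤m m) (<⇒≤ m<n)
  open CycleToPath p₁ a₁ (m+n≤o⇒m≤o∸n 2 5≤m) using (module T₁; module T₂; revDegDist-<)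
  m≡3+p₁ : m ≡ 3 + p₁
  m≡3+p₁ = sym (m+[n∸m]≡n (≤-trans (s≤s (s≤s (s≤s z≤n))) 5≤m))
  U₁≡T₁ : U n m (n ∸ (m + 1) / 2) (n ∸ m) 0 ≡ T₁.G
  U₁≡T₁ = ≡.trans (U₁≡tadpole n m (n ∸ m) c≤n) (cong₂ tadpole m≡3+p₁ (m<n⇒n∸m≡1+n∸[1+m] m<n))
  U₂≡T₂ : U n (m ∸ 2) (n ∸ (m + 1) / 2 + 1) (n ∸ m + 2) 0 ≡ T₂.G
  U₂≡T₂ = ≡.trans (U₂≡tadpole n m (n ∸ m + 2) (≤-trans (s≤s (s≤s z≤n)) 5≤m) c≤n)
                  (cong₂ tadpole (cong (_∸ 2) m≡3+p₁) (cong (_+ 2) (m<n⇒n∸m≡1+n∸[1+m] m<n)))
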